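{- Let $n\ge1$, let $C$ be the $n\times n$ A$_n$ Cartan matrix, and for $M=(M_1,\dots,M_n)$ with non-negative integer entries define \[ R_M(a_1,\dots,a_n;q)=\sum_{\lambda^{(1)},\dots,\lambda^{(n)}}\frac{q^{\frac12\sum_{i,j=1}^n C_{ij}\langle{\lambda^{(i)}}',{\lambda^{(j)}}'\rangle}\prod_{i=1}^n a_i^{|\lambda^{(i)}|}}{\prod_{i=1}^n (q;q)_{M_i-\ell(\lambda^{(i)})}b_{\lambda^{(i)}}(q)}, \] the sum over $n$-tuples of partitions, with $1/(q;q)_{ -k}=0$ for positive integers $k$. Then \[ \sum_{r_1=0}^{M_1}\cdots\sum_{r_n=0}^{M_n}\frac{q^{\frac12\sum_{i,j=1}^n C_{ij}r_ir_j}\prod_{i=1}^n a_i^{r_i}}{\prod_{i=1}^n(q;q)_{M_i-r_i}}R_r(a_1,\dots,a_n;q)=R_M(a_1,\dots,a_n;q), \] where $r=(r_1,\dots,r_n)$.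
   Context: $C_{ij}=2\delta_{i,j}-\delta_{i,j-1}-\delta_{i,j+1}$. For a partition $\lambda$: $\lambda'$ its conjugate, $\ell(\lambda)$ number of nonzero parts, $|\lambda|$ sum of parts, $m_i(\lambda)$ multiplicity of $i$; $\langle\lambda,\mu\rangle=\sum_i\lambda_i\mu_i$; $(q;q)_m=\prod_{i=1}^m(1-q^i)$; $b_\lambda(q)=\prod_{i\ge1}(q;q)_{m_i(\lambda)}$. -}

module Defs where

open import Data.Nat using (ℕ; zero; suc; _∸_; _≤ᵇ_; _≡ᵇ_; _/_)
import Data.Nat as N
open import Data.Integer using (ℤ; +_; -_; _+_; _*_; ∣_∣)
open import Data.Bool using (Bool; true; false; if_then_else_; _∧_)
open import Data.Fin using (Fin; toℕ)
open import Data.List using (List; []; _∷_; map; foldr; zipWith; concatMap; upTo; allFin; filter; length; applyUpTo)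
open import Data.Vec.Functional using (Vector) renaming (_∷_ to _∷ᶠ_)
open import Relation.Nullary.Decidable using (does)
open import Data.Bool.Properties using (T?)

sumℤ : List ℤ → ℤ
sumℤ = foldr _+_ (+ 0)

sumℕ : List ℕ → ℕ
sumℕ = foldr N._+_ 0

ΣFin : (n : ℕ) → (Fin n → ℤ) → ℤ
ΣFin n f = sumℤ (map f (allFin n))

allFinB : (n : ℕ) → (Fin n → Bool) → Bool
allFinB n p = foldr _∧_ true (map p (allFin n))

cartan : (n : ℕ) → Fin n → Fin n → ℤ
cartan n i j =
  if toℕ i ≡ᵇ toℕ j then + 2
  else if (suc (toℕ i) ≡ᵇ toℕ j) then - (+ 1)
  else if (toℕ i ≡ᵇ suc (toℕ j)) then - (+ 1)
  else + 0

-- (1/2) Σ_{i,j} C_ij p(i,j)   (the double sum is a non-negative even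
-- integer in all uses below, so this is exact)
halfCartanForm : (n : ℕ) → (Fin n → Fin n → ℕ) → ℕ
halfCartanForm n p =
  ∣ ΣFin n (λ i → ΣFin n (λ j → cartan n i j * + (p i j))) ∣ / 2

-- Partitions: weakly decreasing lists of positive integers

Partition : Set
Partition = List ℕ

size : Partition → ℕ
size = sumℕ

len : Partition → ℕ
len = length

count : (ℕ → Bool) → List ℕ → ℕ
count p = foldr (λ x c → if p x then suc c else c) 0

mult : ℕ → Partition → ℕ
mult i = count (λ x → x ≡ᵇ i)

-- conjugate: λ'_k = #{ j : λ_j ≥ k },  k = 1, ..., |λ|  (trailing zeros harmless)
conj : Partition → List ℕ
conj λp = applyUpTo (λ k → count (λ x → suc k ≤ᵇ x) λp) (size λp)

-- ⟨λ,μ⟩ = Σ_i λ_i μ_i  (zipWith truncates; missing entries are zero)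
inner : List ℕ → List ℕ → ℕ
inner a b = sumℕ (zipWith N._*_ a b)

isPartitionB : Partition → Bool
isPartitionB [] = true
isPartitionB (x ∷ []) = 1 ≤ᵇ x
isPartitionB (x ∷ y ∷ xs) = (y ≤ᵇ x) ∧ isPartitionB (y ∷ xs)

listsUpTo : ℕ → ℕ → List (List ℕ)
listsUpTo zero B = [] ∷ []
listsUpTo (suc L) B =
  [] ∷ concatMap (λ x → map (x ∷_) (listsUpTo L B)) (applyUpTo suc B)

partitions : ℕ → List Partition
partitions m = filter (λ l → T? (isPartitionB l ∧ (size l ≡ᵇ m))) (listsUpTo m m)

tuples : (n : ℕ) {A : Set} → (Fin n → List A) → List (Vector A n)
tuples zero L = (λ ()) ∷ []
tuples (suc n) L =
  concatMap (λ a → map (λ t → a ∷ᶠ t) (tuples n (λ i → L (Fin.suc i)))) (L Fin.zero)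
  where import Data.Fin as Fin

-- Formal power series in q with integer coefficients:
-- a series is its coefficient function  k ↦ [q^k] f

QS : Set
QS = ℕ → ℤ

zeroS : QS
zeroS _ = + 0

oneS : QS
oneS zero = + 1
oneS (suc _) = + 0

_⊕_ : QS → QS → QS
(f ⊕ g) k = f k + g k

_⊗_ : QS → QS → QS
(f ⊗ g) k = sumℤ (map (λ j → f j * g (k ∸ j)) (upTo (suc k)))

shiftS : ℕ → QS → QS
shiftS e f k = if e ≤ᵇ k then f (k ∸ e) else + 0

sumS : List QS → QS
sumS = foldr _⊕_ zeroS

prodS : List QS → QS
prodS = foldr _⊗_ oneS

oneMinusQ : ℕ → QS
oneMinusQ i k = (if k ≡ᵇ 0 then + 1 else + 0) + (if k ≡ᵇ i then - (+ 1) else + 0)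

poch : ℕ → QS
poch m = prodS (applyUpTo (λ i → oneMinusQ (suc i)) m)

private
  headOr0 : List ℤ → ℤ
  headOr0 [] = + 0
  headOr0 (x ∷ _) = x

-- coefficients c_k, …, c_0 of the formal inverse 1/f (for f with f 0 = 1):
-- c_0 = 1,  c_{k+1} = - Σ_{j=1}^{k+1} f_j c_{k+1-j}
invRev : QS → ℕ → List ℤ
invRev f zero = + 1 ∷ []
invRev f (suc k) =
  - sumℤ (zipWith _*_ (map (λ j → f (suc j)) (upTo (suc k))) (invRev f k)) ∷ invRev f k

inv : QS → QS
inv f k = headOr0 (invRev f k)

-- b_λ(q) = Π_{i ≥ 1} (q;q)_{m_i(λ)}  (factors with i > |λ| equal 1)
bPoly : Partition → QS
bPoly λp = prodS (applyUpTo (λ i → poch (mult (suc i) λp)) (size λp))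

-- Formal power series in a_1,…,a_n,q: coefficient of a^d (d : Fin n → ℕ)
-- is a q-series

MS : ℕ → Set
MS n = (Fin n → ℕ) → QS

sumMS : {n : ℕ} → List (MS n) → MS n
sumMS {n} Fs d = sumS (map (λ F → F d) Fs)

mulA : {n : ℕ} → (Fin n → ℕ) → MS n → MS n
mulA {n} r F d =
  if allFinB n (λ i → r i ≤ᵇ d i) then F (λ i → d i ∸ r i) else zeroS

scaleQ : {n : ℕ} → QS → MS n → MS n
scaleQ c F d = c ⊗ F d

-- R_M(a_1,…,a_n;q).  The coefficient of a^d collects exactly the
-- n-tuples of partitions with |λ^{(i)}| = d_i.  A summand with
-- ℓ(λ^{(i)}) > M_i for some i vanishes (1/(q;q)_{-k} = 0).

RTerm : (n : ℕ) → (Fin n → ℕ) → Vector Partition n → QS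
RTerm n M λs =
  if allFinB n (λ i → len (λs i) ≤ᵇ M i)
  then shiftS (halfCartanForm n (λ i j → inner (conj (λs i)) (conj (λs j))))
              (inv (prodS (map (λ i → poch (M i ∸ len (λs i)) ⊗ bPoly (λs i)) (allFin n))))
  else zeroS

R : (n : ℕ) → (Fin n → ℕ) → MS n
R n M d = sumS (map (RTerm n M) (tuples n (λ i → partitions (d i))))

box : (n : ℕ) → (Fin n → ℕ) → List (Fin n → ℕ)
box n M = tuples n (λ i → upTo (suc (M i)))

LHS : (n : ℕ) → (Fin n → ℕ) → MS n
LHS n M =
  sumMS (map (λ r → mulA r (scaleQ
      (shiftS (halfCartanForm n (λ i j → r i N.* r j))
              (inv (prodS (map (λ i → poch (M i ∸ r i)) (allFin n)))))
      (R n r))) (box n M))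

module Submission where

-- Write a partition λ with ℓ(λ) = r as a first column of height r next to the partition
-- μ = (λ₁ - 1, λ₂ - 1, …) left after removing it; μ runs over the partitions of |λ| - r with ℓ(μ) ≤ r.
-- Then λ′ = (r, μ′₁, μ′₂, …), so ⟨λ⁽ⁱ⁾′, λ⁽ʲ⁾′⟩ = rᵢ rⱼ + ⟨μ⁽ⁱ⁾′, μ⁽ʲ⁾′⟩, and m₁(λ) = r - ℓ(μ),
-- m_{j+1}(λ) = m_j(μ), so b_λ = (q;q)_{r-ℓ(μ)} b_μ. Hence the summand of R_M indexed by (λ⁽¹⁾, …, λ⁽ⁿ⁾)
-- is the r-summand of the left-hand side times the summand of R_r indexed by (μ⁽¹⁾, …, μ⁽ⁿ⁾), and the
-- bijection λ ↔ (r, μ) matches the two sums coefficientwise.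
-- The exponent is computed as |Σ Cᵢⱼ pᵢⱼ| / 2 in ℕ. This is additive in p because every double sum that
-- occurs is a sum of forms xᵀCx with x ∈ ℕⁿ, and xᵀCx = x₁² + Σ (xᵢ - xᵢ₊₁)² + xₙ² is even and non-negative.

open import Defs

open import Data.Bool using (Bool; true; false; if_then_else_; T; _∧_)
import Data.Bool.Properties as Boolₚ
open Boolₚ using (T?)
open import Data.Empty using (⊥-elim)
open import Data.Fin as Fin using (Fin)
open import Data.Fin.Patterns using (0F; 1F)
open import Data.Integer as ℤ using (ℤ; +_; -_; _+_; _-_; _*_; ∣_∣; 0ℤ; -1ℤ)
import Data.Integer.Properties as ℤₚ
open import Data.Integer.Tactic.RingSolver using (solve-∀)
open import Data.List
  using (List; []; _∷_; _++_; foldr; map; concatMap; zipWith; applyUpTo; upTo; allFin; replicate; length; filter)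
import Data.List.Properties as Listₚ
open import Data.List.Membership.Propositional using (_∈_; find; lose)
import Data.List.Membership.Propositional.Properties as ∈ₚ
open import Data.List.Membership.Propositional.Properties.WithK using (unique∧set⇒bag)
open import Data.List.Relation.Binary.BagAndSetEquality using (∼bag⇒↭)
open import Data.List.Relation.Binary.Permutation.Propositional using (_↭_; ↭⇒↭ₛ)
import Data.List.Relation.Binary.Permutation.Propositional.Properties as ↭ₚ
open import Data.List.Relation.Binary.Permutation.Setoid.Properties using (foldr-commMonoid)
open import Data.List.Relation.Unary.All as All using (All; []; _∷_)
import Data.List.Relation.Unary.All.Properties as Allₚ
open import Data.List.Relation.Unary.AllPairs as AllPairs using ([]; _∷_)
import Data.List.Relation.Unary.AllPairs.Properties as AllPairsₚ
open import Data.List.Relation.Unary.Any as Any using (here; there)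
open import Data.List.Relation.Unary.Unique.Propositional using (Unique)
import Data.List.Relation.Unary.Unique.Propositional.Properties as Uniqueₚ
open import Data.Nat as ℕ using (ℕ; zero; suc; _∸_; _≤ᵇ_; _≤_; _<_; z≤n; s≤s; _/_)
import Data.Nat.Properties as ℕₚ
open import Data.Nat.DivMod using (m*n/n≡m)
open import Data.Nat.ListAction.Properties using (sum-++)
open import Data.Product using (Σ-syntax; _×_; _,_; proj₁; proj₂; uncurry)
open import Data.Unit using (tt)
open import Data.Vec.Functional using () renaming (_∷_ to _∷ᶠ_)
open import Function using (_∘_)
open import Function.Bundles using (Equivalence; mk⇔)
open import Relation.Binary.PropositionalEquality
import Relation.Binary.Reasoning.Setoid as SetoidReasoning
open import Relation.Nullary using (¬_; yes; no)
open import Relation.Nullary.Decidable using (dec-true; dec-false; _×-dec_)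
open import Relation.Unary using (Decidable)

-- Formal power series in q

module ≗-Reasoning = SetoidReasoning (ℕ →-setoid ℤ)

Σ< : ℕ → (ℕ → ℤ) → ℤ
Σ< zero    h = 0ℤ
Σ< (suc n) h = h 0 + Σ< n (h ∘ suc)

Σ<-cong : ∀ n {f g} → (∀ j → j < n → f j ≡ g j) → Σ< n f ≡ Σ< n g
Σ<-cong zero    f≡g = refl
Σ<-cong (suc n) f≡g = cong₂ _+_ (f≡g 0 (s≤s z≤n)) (Σ<-cong n (λ j j<n → f≡g (suc j) (s≤s j<n)))

Σ<-zero : ∀ n → Σ< n (λ _ → 0ℤ) ≡ 0ℤ
Σ<-zero zero    = refl
Σ<-zero (suc n) = trans (ℤₚ.+-identityˡ _) (Σ<-zero n)

Σ<-distrib-+ : ∀ n f g → Σ< n (λ j → f j + g j) ≡ Σ< n f + Σ< n g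
Σ<-distrib-+ zero    f g = refl
Σ<-distrib-+ (suc n) f g =
  trans (cong (_+_ (f 0 + g 0)) (Σ<-distrib-+ n (f ∘ suc) (g ∘ suc))) (interchange (f 0) (g 0) _ _)
  where
  interchange : ∀ (a b c d : ℤ) → a + b + (c + d) ≡ a + c + (b + d)
  interchange = solve-∀

Σ<-distribˡ-* : ∀ n c f → Σ< n (λ j → c * f j) ≡ c * Σ< n f
Σ<-distribˡ-* zero    c f = sym (ℤₚ.*-zeroʳ c)
Σ<-distribˡ-* (suc n) c f =
  trans (cong (_+_ (c * f 0)) (Σ<-distribˡ-* n c (f ∘ suc))) (sym (ℤₚ.*-distribˡ-+ c (f 0) _))

Σ<-suc-last : ∀ n h → Σ< (suc n) h ≡ Σ< n h + h n
Σ<-suc-last zero    h = ℤₚ.+-comm (h 0) 0ℤ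
Σ<-suc-last (suc n) h =
  trans (cong (_+_ (h 0)) (Σ<-suc-last n (h ∘ suc))) (sym (ℤₚ.+-assoc (h 0) _ _))

Σ<-reverse : ∀ n h → Σ< n h ≡ Σ< n (λ j → h (n ∸ suc j))
Σ<-reverse zero    h = refl
Σ<-reverse (suc n) h = begin
  h 0 + Σ< n (h ∘ suc)
    ≡⟨ cong (_+_ (h 0)) (Σ<-reverse n (h ∘ suc)) ⟩
  h 0 + Σ< n (λ j → h (suc (n ∸ suc j)))
    ≡⟨ ℤₚ.+-comm (h 0) _ ⟩
  Σ< n (λ j → h (suc (n ∸ suc j))) + h 0
    ≡⟨ cong₂ _+_ (Σ<-cong n (λ j j<n → cong h (sym (ℕₚ.+-∸-assoc 1 j<n)))) (cong h (sym (ℕₚ.n∸n≡0 n))) ⟩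
  Σ< n (λ j → h (n ∸ j)) + h (n ∸ n)
    ≡⟨ Σ<-suc-last n (λ j → h (n ∸ j)) ⟨
  Σ< (suc n) (λ j → h (n ∸ j))
    ∎
  where open ≡-Reasoning

sumℤ-applyUpTo : ∀ (f : ℕ → ℤ) (g : ℕ → ℕ) n → sumℤ (map f (applyUpTo g n)) ≡ Σ< n (f ∘ g)
sumℤ-applyUpTo f g zero    = refl
sumℤ-applyUpTo f g (suc n) = cong (_+_ (f (g 0))) (sumℤ-applyUpTo f (g ∘ suc) n)

⊗-coeff : ∀ f g k → (f ⊗ g) k ≡ Σ< (suc k) (λ j → f j * g (k ∸ j))
⊗-coeff f g k = sumℤ-applyUpTo (λ j → f j * g (k ∸ j)) (λ j → j) (suc k)

tailS : QS → QS
tailS f k = f (suc k)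

scaleS : ℤ → QS → QS
scaleS c f k = c * f k

⊗-zero-coeff : ∀ f g → (f ⊗ g) 0 ≡ f 0 * g 0
⊗-zero-coeff f g = ℤₚ.+-identityʳ _

⊗-suc-coeff : ∀ f g k → (f ⊗ g) (suc k) ≡ f 0 * g (suc k) + (tailS f ⊗ g) k
⊗-suc-coeff f g k = trans (⊗-coeff f g (suc k)) (cong (_+_ (f 0 * g (suc k))) (sym (⊗-coeff (tailS f) g k)))

⊗-cong : ∀ {f f′ g g′} → f ≗ f′ → g ≗ g′ → f ⊗ g ≗ f′ ⊗ g′
⊗-cong {f} {f′} {g} {g′} f≗f′ g≗g′ k = begin
  (f ⊗ g) k                                ≡⟨ ⊗-coeff f g k ⟩
  Σ< (suc k) (λ j → f j * g (k ∸ j))       ≡⟨ Σ<-cong (suc k) (λ j _ → cong₂ _*_ (f≗f′ j) (g≗g′ (k ∸ j))) ⟩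
  Σ< (suc k) (λ j → f′ j * g′ (k ∸ j))     ≡⟨ ⊗-coeff f′ g′ k ⟨
  (f′ ⊗ g′) k                              ∎
  where open ≡-Reasoning

⊗-congˡ : ∀ f {g g′} → g ≗ g′ → f ⊗ g ≗ f ⊗ g′
⊗-congˡ f = ⊗-cong {f} (λ _ → refl)

⊗-congʳ : ∀ {f f′} g → f ≗ f′ → f ⊗ g ≗ f′ ⊗ g
⊗-congʳ g f≗f′ = ⊗-cong f≗f′ (λ _ → refl)

⊗-comm : ∀ f g → f ⊗ g ≗ g ⊗ f
⊗-comm f g k = begin
  (f ⊗ g) k                                             ≡⟨ ⊗-coeff f g k ⟩
  Σ< (suc k) (λ j → f j * g (k ∸ j))                    ≡⟨ Σ<-reverse (suc k) (λ j → f j * g (k ∸ j)) ⟩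
  Σ< (suc k) (λ j → f (k ∸ j) * g (k ∸ (k ∸ j)))        ≡⟨ Σ<-cong (suc k) swap ⟩
  Σ< (suc k) (λ j → g j * f (k ∸ j))                    ≡⟨ ⊗-coeff g f k ⟨
  (g ⊗ f) k                                             ∎
  where
  open ≡-Reasoning
  swap : ∀ j → j < suc k → f (k ∸ j) * g (k ∸ (k ∸ j)) ≡ g j * f (k ∸ j)
  swap j (s≤s j≤k) = trans (cong (λ i → f (k ∸ j) * g i) (ℕₚ.m∸[m∸n]≡n j≤k)) (ℤₚ.*-comm (f (k ∸ j)) (g j))

⊗-distribʳ-⊕ : ∀ f g h → (f ⊕ g) ⊗ h ≗ (f ⊗ h) ⊕ (g ⊗ h)
⊗-distribʳ-⊕ f g h k = begin
  ((f ⊕ g) ⊗ h) k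
    ≡⟨ ⊗-coeff (f ⊕ g) h k ⟩
  Σ< (suc k) (λ j → (f j + g j) * h (k ∸ j))
    ≡⟨ Σ<-cong (suc k) (λ j _ → ℤₚ.*-distribʳ-+ (h (k ∸ j)) (f j) (g j)) ⟩
  Σ< (suc k) (λ j → f j * h (k ∸ j) + g j * h (k ∸ j))
    ≡⟨ Σ<-distrib-+ (suc k) (λ j → f j * h (k ∸ j)) (λ j → g j * h (k ∸ j)) ⟩
  Σ< (suc k) (λ j → f j * h (k ∸ j)) + Σ< (suc k) (λ j → g j * h (k ∸ j))
    ≡⟨ cong₂ _+_ (⊗-coeff f h k) (⊗-coeff g h k) ⟨
  ((f ⊗ h) ⊕ (g ⊗ h)) k
    ∎
  where open ≡-Reasoning

⊗-distribˡ-⊕ : ∀ h f g → h ⊗ (f ⊕ g) ≗ (h ⊗ f) ⊕ (h ⊗ g)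
⊗-distribˡ-⊕ h f g k =
  trans (⊗-comm h (f ⊕ g) k) (trans (⊗-distribʳ-⊕ f g h k) (cong₂ _+_ (⊗-comm f h k) (⊗-comm g h k)))

scaleS-⊗ : ∀ c f h → scaleS c f ⊗ h ≗ scaleS c (f ⊗ h)
scaleS-⊗ c f h k = begin
  (scaleS c f ⊗ h) k                          ≡⟨ ⊗-coeff (scaleS c f) h k ⟩
  Σ< (suc k) (λ j → c * f j * h (k ∸ j))      ≡⟨ Σ<-cong (suc k) (λ j _ → ℤₚ.*-assoc c (f j) (h (k ∸ j))) ⟩
  Σ< (suc k) (λ j → c * (f j * h (k ∸ j)))    ≡⟨ Σ<-distribˡ-* (suc k) c (λ j → f j * h (k ∸ j)) ⟩
  c * Σ< (suc k) (λ j → f j * h (k ∸ j))      ≡⟨ cong (c *_) (⊗-coeff f h k) ⟨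
  scaleS c (f ⊗ h) k                          ∎
  where open ≡-Reasoning

⊗-assoc : ∀ f g h → (f ⊗ g) ⊗ h ≗ f ⊗ (g ⊗ h)
⊗-assoc f g h zero = begin
  ((f ⊗ g) ⊗ h) 0      ≡⟨ trans (⊗-zero-coeff (f ⊗ g) h) (cong (_* h 0) (⊗-zero-coeff f g)) ⟩
  f 0 * g 0 * h 0      ≡⟨ ℤₚ.*-assoc (f 0) (g 0) (h 0) ⟩
  f 0 * (g 0 * h 0)    ≡⟨ trans (⊗-zero-coeff f (g ⊗ h)) (cong (f 0 *_) (⊗-zero-coeff g h)) ⟨
  (f ⊗ (g ⊗ h)) 0      ∎
  where open ≡-Reasoning
⊗-assoc f g h (suc k) = begin
  ((f ⊗ g) ⊗ h) (suc k)
    ≡⟨ ⊗-suc-coeff (f ⊗ g) h k ⟩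
  (f ⊗ g) 0 * h (suc k) + (tailS (f ⊗ g) ⊗ h) k
    ≡⟨ cong₂ _+_ (cong (_* h (suc k)) (⊗-zero-coeff f g)) (⊗-congʳ h (⊗-suc-coeff f g) k) ⟩
  f 0 * g 0 * h (suc k) + ((scaleS (f 0) (tailS g) ⊕ (tailS f ⊗ g)) ⊗ h) k
    ≡⟨ cong (_+_ (f 0 * g 0 * h (suc k))) (⊗-distribʳ-⊕ (scaleS (f 0) (tailS g)) (tailS f ⊗ g) h k) ⟩
  f 0 * g 0 * h (suc k) + ((scaleS (f 0) (tailS g) ⊗ h) k + ((tailS f ⊗ g) ⊗ h) k)
    ≡⟨ cong (_+_ (f 0 * g 0 * h (suc k))) (cong₂ _+_ (scaleS-⊗ (f 0) (tailS g) h k) (⊗-assoc (tailS f) g h k)) ⟩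
  f 0 * g 0 * h (suc k) + (f 0 * (tailS g ⊗ h) k + (tailS f ⊗ (g ⊗ h)) k)
    ≡⟨ regroup (f 0) (g 0) (h (suc k)) _ _ ⟩
  f 0 * (g 0 * h (suc k) + (tailS g ⊗ h) k) + (tailS f ⊗ (g ⊗ h)) k
    ≡⟨ cong (λ x → f 0 * x + (tailS f ⊗ (g ⊗ h)) k) (⊗-suc-coeff g h k) ⟨
  f 0 * (g ⊗ h) (suc k) + (tailS f ⊗ (g ⊗ h)) k
    ≡⟨ ⊗-suc-coeff f (g ⊗ h) k ⟨
  (f ⊗ (g ⊗ h)) (suc k)
    ∎
  where
  open ≡-Reasoning
  regroup : ∀ (a b c d e : ℤ) → a * b * c + (a * d + e) ≡ a * (b * c + d) + e
  regroup = solve-∀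

zeroS-⊗ : ∀ f → zeroS ⊗ f ≗ zeroS
zeroS-⊗ f k = trans (⊗-coeff zeroS f k) (Σ<-zero (suc k))

⊗-zeroS : ∀ f → f ⊗ zeroS ≗ zeroS
⊗-zeroS f k = trans (⊗-comm f zeroS k) (zeroS-⊗ f k)

oneS-⊗ : ∀ f → oneS ⊗ f ≗ f
oneS-⊗ f zero    = trans (⊗-zero-coeff oneS f) (ℤₚ.*-identityˡ (f 0))
oneS-⊗ f (suc k) = trans (⊗-suc-coeff oneS f k)
                     (trans (cong₂ _+_ (ℤₚ.*-identityˡ (f (suc k))) (zeroS-⊗ f k)) (ℤₚ.+-identityʳ _))

⊗-oneS : ∀ f → f ⊗ oneS ≗ f
⊗-oneS f k = trans (⊗-comm f oneS k) (oneS-⊗ f k)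

⊗-interchange : ∀ a b c d → (a ⊗ b) ⊗ (c ⊗ d) ≗ (a ⊗ c) ⊗ (b ⊗ d)
⊗-interchange a b c d = begin
  (a ⊗ b) ⊗ (c ⊗ d)    ≈⟨ ⊗-assoc a b (c ⊗ d) ⟩
  a ⊗ (b ⊗ (c ⊗ d))    ≈⟨ ⊗-congˡ a (⊗-assoc b c d) ⟨
  a ⊗ ((b ⊗ c) ⊗ d)    ≈⟨ ⊗-congˡ a (⊗-congʳ d (⊗-comm b c)) ⟩
  a ⊗ ((c ⊗ b) ⊗ d)    ≈⟨ ⊗-congˡ a (⊗-assoc c b d) ⟩
  a ⊗ (c ⊗ (b ⊗ d))    ≈⟨ ⊗-assoc a c (b ⊗ d) ⟨
  (a ⊗ c) ⊗ (b ⊗ d)    ∎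
  where open ≗-Reasoning

mulQ : QS → QS
mulQ f zero    = 0ℤ
mulQ f (suc k) = f k

mulQ-cong : ∀ {f g} → f ≗ g → mulQ f ≗ mulQ g
mulQ-cong f≗g zero    = refl
mulQ-cong f≗g (suc k) = f≗g k

mulQ-⊗ : ∀ f g → mulQ f ⊗ g ≗ mulQ (f ⊗ g)
mulQ-⊗ f g zero    = refl
mulQ-⊗ f g (suc k) = trans (⊗-suc-coeff (mulQ f) g k) (ℤₚ.+-identityˡ _)

shiftS-suc : ∀ a f → shiftS (suc a) f ≗ mulQ (shiftS a f)
shiftS-suc a       f zero    = refl
shiftS-suc zero    f (suc k) = refl
shiftS-suc (suc a) f (suc k) = refl

shiftS-cong : ∀ a {f g} → f ≗ g → shiftS a f ≗ shiftS a g
shiftS-cong a f≗g k with a ≤ᵇ k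
... | true  = f≗g (k ∸ a)
... | false = refl

shiftS-⊗ : ∀ a f g → shiftS a f ⊗ g ≗ shiftS a (f ⊗ g)
shiftS-⊗ zero    f g = ⊗-congʳ {shiftS 0 f} {f} g (λ _ → refl)
shiftS-⊗ (suc a) f g = begin
  shiftS (suc a) f ⊗ g      ≈⟨ ⊗-congʳ g (shiftS-suc a f) ⟩
  mulQ (shiftS a f) ⊗ g     ≈⟨ mulQ-⊗ (shiftS a f) g ⟩
  mulQ (shiftS a f ⊗ g)     ≈⟨ mulQ-cong (shiftS-⊗ a f g) ⟩
  mulQ (shiftS a (f ⊗ g))   ≈⟨ shiftS-suc a (f ⊗ g) ⟨
  shiftS (suc a) (f ⊗ g)    ∎
  where open ≗-Reasoning

shiftS-shiftS : ∀ a b f → shiftS a (shiftS b f) ≗ shiftS (a ℕ.+ b) f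
shiftS-shiftS zero    b f k = refl
shiftS-shiftS (suc a) b f = begin
  shiftS (suc a) (shiftS b f)     ≈⟨ shiftS-suc a (shiftS b f) ⟩
  mulQ (shiftS a (shiftS b f))    ≈⟨ mulQ-cong (shiftS-shiftS a b f) ⟩
  mulQ (shiftS (a ℕ.+ b) f)       ≈⟨ shiftS-suc (a ℕ.+ b) f ⟨
  shiftS (suc a ℕ.+ b) f          ∎
  where open ≗-Reasoning

shiftS-⊗-shiftS : ∀ a b f g → shiftS a f ⊗ shiftS b g ≗ shiftS (a ℕ.+ b) (f ⊗ g)
shiftS-⊗-shiftS a b f g = begin
  shiftS a f ⊗ shiftS b g         ≈⟨ shiftS-⊗ a f (shiftS b g) ⟩
  shiftS a (f ⊗ shiftS b g)       ≈⟨ shiftS-cong a (⊗-comm f (shiftS b g)) ⟩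
  shiftS a (shiftS b g ⊗ f)       ≈⟨ shiftS-cong a (shiftS-⊗ b g f) ⟩
  shiftS a (shiftS b (g ⊗ f))     ≈⟨ shiftS-shiftS a b (g ⊗ f) ⟩
  shiftS (a ℕ.+ b) (g ⊗ f)        ≈⟨ shiftS-cong (a ℕ.+ b) (⊗-comm g f) ⟩
  shiftS (a ℕ.+ b) (f ⊗ g)        ∎
  where open ≗-Reasoning

invRev-sum : ∀ f (g : ℕ → ℤ) k →
             sumℤ (zipWith _*_ (applyUpTo g (suc k)) (invRev f k)) ≡ Σ< (suc k) (λ j → g j * inv f (k ∸ j))
invRev-sum f g zero    = refl
invRev-sum f g (suc k) = cong (_+_ (g 0 * inv f (suc k))) (invRev-sum f (g ∘ suc) k)

inv-suc-coeff : ∀ f k → inv f (suc k) ≡ - Σ< (suc k) (λ j → f (suc j) * inv f (k ∸ j))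
inv-suc-coeff f k = cong -_ (trans (cong (λ l → sumℤ (zipWith _*_ l (invRev f k))) (Listₚ.map-upTo (f ∘ suc) (suc k)))
                                   (invRev-sum f (f ∘ suc) k))

⊗-const : ∀ f g → f 0 ≡ + 1 → g 0 ≡ + 1 → (f ⊗ g) 0 ≡ + 1
⊗-const f g f₀ g₀ = trans (⊗-zero-coeff f g) (cong₂ _*_ f₀ g₀)

⊗-inv : ∀ f → f 0 ≡ + 1 → f ⊗ inv f ≗ oneS
⊗-inv f f₀ zero    = trans (⊗-zero-coeff f (inv f)) (cong (_* + 1) f₀)
⊗-inv f f₀ (suc k) = begin
  (f ⊗ inv f) (suc k)
    ≡⟨ ⊗-suc-coeff f (inv f) k ⟩
  f 0 * inv f (suc k) + (tailS f ⊗ inv f) k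
    ≡⟨ cong₂ _+_ (cong₂ _*_ f₀ (inv-suc-coeff f k)) (⊗-coeff (tailS f) (inv f) k) ⟩
  + 1 * (- S) + S
    ≡⟨ cong (_+ S) (ℤₚ.*-identityˡ (- S)) ⟩
  - S + S
    ≡⟨ ℤₚ.+-inverseˡ S ⟩
  0ℤ
    ∎
  where
  open ≡-Reasoning
  S = Σ< (suc k) (λ j → f (suc j) * inv f (k ∸ j))

inv-unique : ∀ f h → f 0 ≡ + 1 → f ⊗ h ≗ oneS → h ≗ inv f
inv-unique f h f₀ fh≗1 = begin
  h                     ≈⟨ ⊗-oneS h ⟨
  h ⊗ oneS              ≈⟨ ⊗-congˡ h (⊗-inv f f₀) ⟨
  h ⊗ (f ⊗ inv f)       ≈⟨ ⊗-assoc h f (inv f) ⟨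
  (h ⊗ f) ⊗ inv f       ≈⟨ ⊗-congʳ (inv f) (λ k → trans (⊗-comm h f k) (fh≗1 k)) ⟩
  oneS ⊗ inv f          ≈⟨ oneS-⊗ (inv f) ⟩
  inv f                 ∎
  where open ≗-Reasoning

inv-cong : ∀ {f g} → f 0 ≡ + 1 → f ≗ g → inv f ≗ inv g
inv-cong {f} {g} f₀ f≗g = λ k → sym (inv-unique f (inv g) f₀ f⊗invg≗1 k)
  where
  f⊗invg≗1 : f ⊗ inv g ≗ oneS
  f⊗invg≗1 k = trans (⊗-congʳ (inv g) f≗g k) (⊗-inv g (trans (sym (f≗g 0)) f₀) k)

inv-⊗ : ∀ f g → f 0 ≡ + 1 → g 0 ≡ + 1 → inv f ⊗ inv g ≗ inv (f ⊗ g)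
inv-⊗ f g f₀ g₀ = inv-unique (f ⊗ g) (inv f ⊗ inv g) (⊗-const f g f₀ g₀) (begin
  (f ⊗ g) ⊗ (inv f ⊗ inv g)    ≈⟨ ⊗-interchange f g (inv f) (inv g) ⟩
  (f ⊗ inv f) ⊗ (g ⊗ inv g)    ≈⟨ ⊗-cong (⊗-inv f f₀) (⊗-inv g g₀) ⟩
  oneS ⊗ oneS                  ≈⟨ oneS-⊗ oneS ⟩
  oneS                         ∎)
  where open ≗-Reasoning

prodS-cong : ∀ {A : Set} {f g : A → QS} (xs : List A) → (∀ x → f x ≗ g x) → prodS (map f xs) ≗ prodS (map g xs)
prodS-cong []       f≗g = λ _ → refl
prodS-cong (x ∷ xs) f≗g = ⊗-cong (f≗g x) (prodS-cong xs f≗g)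

prodS-map-⊗ : ∀ {A : Set} (f g : A → QS) (xs : List A) →
              prodS (map (λ x → f x ⊗ g x) xs) ≗ prodS (map f xs) ⊗ prodS (map g xs)
prodS-map-⊗ f g []       = λ k → sym (oneS-⊗ oneS k)
prodS-map-⊗ f g (x ∷ xs) = begin
  (f x ⊗ g x) ⊗ prodS (map (λ x → f x ⊗ g x) xs)        ≈⟨ ⊗-congˡ (f x ⊗ g x) (prodS-map-⊗ f g xs) ⟩
  (f x ⊗ g x) ⊗ (prodS (map f xs) ⊗ prodS (map g xs))   ≈⟨ ⊗-interchange (f x) (g x) _ _ ⟩
  (f x ⊗ prodS (map f xs)) ⊗ (g x ⊗ prodS (map g xs))   ∎
  where open ≗-Reasoning

prodS-const : ∀ fs → All (λ f → f 0 ≡ + 1) fs → prodS fs 0 ≡ + 1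
prodS-const []       []         = refl
prodS-const (f ∷ fs) (f₀ ∷ fs₀) = ⊗-const f (prodS fs) f₀ (prodS-const fs fs₀)

poch-const : ∀ m → poch m 0 ≡ + 1
poch-const m = prodS-const _ (Allₚ.applyUpTo⁺₂ (λ i → oneMinusQ (suc i)) m (λ _ → refl))

bPoly-const : ∀ λp → bPoly λp 0 ≡ + 1
bPoly-const λp = prodS-const _ (Allₚ.applyUpTo⁺₂ (λ i → poch (mult (suc i) λp)) (size λp) (λ i → poch-const (mult (suc i) λp)))

∑ : {A : Set} → List A → (A → ℤ) → ℤ
∑ xs f = sumℤ (map f xs)

∑-cong : ∀ {A : Set} (xs : List A) {f g : A → ℤ} → (∀ x → x ∈ xs → f x ≡ g x) → ∑ xs f ≡ ∑ xs g
∑-cong []       f≡g = refl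
∑-cong (x ∷ xs) f≡g = cong₂ _+_ (f≡g x (here refl)) (∑-cong xs (λ y y∈xs → f≡g y (there y∈xs)))

∑-zero : ∀ {A : Set} (xs : List A) → ∑ xs (λ _ → 0ℤ) ≡ 0ℤ
∑-zero []       = refl
∑-zero (x ∷ xs) = trans (ℤₚ.+-identityˡ _) (∑-zero xs)

∑-++ : ∀ {A : Set} (xs ys : List A) f → ∑ (xs ++ ys) f ≡ ∑ xs f + ∑ ys f
∑-++ []       ys f = sym (ℤₚ.+-identityˡ _)
∑-++ (x ∷ xs) ys f = trans (cong (_+_ (f x)) (∑-++ xs ys f)) (sym (ℤₚ.+-assoc (f x) (∑ xs f) (∑ ys f)))

∑-map : ∀ {A B : Set} (g : A → B) (xs : List A) f → ∑ (map g xs) f ≡ ∑ xs (f ∘ g)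
∑-map g []       f = refl
∑-map g (x ∷ xs) f = cong (_+_ (f (g x))) (∑-map g xs f)

∑-concatMap : ∀ {A B : Set} (g : A → List B) (xs : List A) f → ∑ (concatMap g xs) f ≡ ∑ xs (λ x → ∑ (g x) f)
∑-concatMap g []       f = refl
∑-concatMap g (x ∷ xs) f = trans (∑-++ (g x) (concatMap g xs) f) (cong (_+_ (∑ (g x) f)) (∑-concatMap g xs f))

∑-distrib-+ : ∀ {A : Set} (xs : List A) f g → ∑ xs (λ x → f x + g x) ≡ ∑ xs f + ∑ xs g
∑-distrib-+ []       f g = refl
∑-distrib-+ (x ∷ xs) f g =
  trans (cong (_+_ (f x + g x)) (∑-distrib-+ xs f g)) (interchange (f x) (g x) (∑ xs f) (∑ xs g))
  where
  interchange : ∀ (a b c d : ℤ) → a + b + (c + d) ≡ a + c + (b + d)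
  interchange = solve-∀

∑-swap : ∀ {A B : Set} (xs : List A) (ys : List B) (f : A → B → ℤ) →
         ∑ xs (λ x → ∑ ys (f x)) ≡ ∑ ys (λ y → ∑ xs (λ x → f x y))
∑-swap []       ys f = sym (∑-zero ys)
∑-swap (x ∷ xs) ys f =
  trans (cong (_+_ (∑ ys (f x))) (∑-swap xs ys f)) (sym (∑-distrib-+ ys (f x) (λ y → ∑ xs (λ x → f x y))))

∑-↭ : ∀ {A : Set} {xs ys : List A} f → xs ↭ ys → ∑ xs f ≡ ∑ ys f
∑-↭ f xs↭ys = foldr-commMonoid (setoid ℤ) ℤₚ.+-0-isCommutativeMonoid (↭⇒↭ₛ (↭ₚ.map⁺ f xs↭ys))

sumS-coeff : ∀ {A : Set} (F : A → QS) (xs : List A) k → sumS (map F xs) k ≡ ∑ xs (λ x → F x k)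
sumS-coeff F []       k = refl
sumS-coeff F (x ∷ xs) k = cong (_+_ (F x k)) (sumS-coeff F xs k)

⊗-sumS : ∀ {A : Set} (s : QS) (F : A → QS) (xs : List A) k → (s ⊗ sumS (map F xs)) k ≡ ∑ xs (λ x → (s ⊗ F x) k)
⊗-sumS s F []       k = ⊗-zeroS s k
⊗-sumS s F (x ∷ xs) k =
  trans (⊗-distribˡ-⊕ s (F x) (sumS (map F xs)) k) (cong (_+_ ((s ⊗ F x) k)) (⊗-sumS s F xs k))

ΣFin-suc : ∀ n (f : Fin (suc n) → ℤ) → ΣFin (suc n) f ≡ f 0F + ΣFin n (f ∘ Fin.suc)
ΣFin-suc n f = cong (λ xs → f 0F + sumℤ xs) (trans (Listₚ.map-tabulate Fin.suc f)
                                                          (sym (Listₚ.map-tabulate (λ i → i) (f ∘ Fin.suc))))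

ΣFin-head : ∀ n (f : Fin (suc n) → ℤ) → (∀ j → f (Fin.suc j) ≡ 0ℤ) → ΣFin (suc n) f ≡ f 0F
ΣFin-head n f tail≡0 = begin
  ΣFin (suc n) f
    ≡⟨ ΣFin-suc n f ⟩
  f 0F + ΣFin n (f ∘ Fin.suc)
    ≡⟨ cong (_+_ (f 0F)) (trans (∑-cong (allFin n) (λ j _ → tail≡0 j)) (∑-zero (allFin n))) ⟩
  f 0F + 0ℤ
    ≡⟨ ℤₚ.+-identityʳ (f 0F) ⟩
  f 0F
    ∎
  where open ≡-Reasoning

-- The Cartan form

cartanSum : (n : ℕ) → (Fin n → Fin n → ℕ) → ℤ
cartanSum n p = ΣFin n (λ i → ΣFin n (λ j → cartan n i j * + p i j))

cartanSum-cong : ∀ n {p q : Fin n → Fin n → ℕ} → (∀ i j → p i j ≡ q i j) → cartanSum n p ≡ cartanSum n q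
cartanSum-cong n p≡q =
  ∑-cong (allFin n) (λ i _ → ∑-cong (allFin n) (λ j _ → cong (λ x → cartan n i j * + x) (p≡q i j)))

cartanSum-+ : ∀ n (p q : Fin n → Fin n → ℕ) → cartanSum n (λ i j → p i j ℕ.+ q i j) ≡ cartanSum n p + cartanSum n q
cartanSum-+ n p q = begin
  ΣFin n (λ i → ΣFin n (λ j → C i j * + (p i j ℕ.+ q i j)))
    ≡⟨ ∑-cong (allFin n) (λ i _ → ∑-cong (allFin n) (λ j _ →
         trans (cong (_*_ (C i j)) (ℤₚ.pos-+ (p i j) (q i j))) (ℤₚ.*-distribˡ-+ (C i j) (+ p i j) (+ q i j)))) ⟩
  ΣFin n (λ i → ΣFin n (λ j → C i j * + p i j + C i j * + q i j))
    ≡⟨ ∑-cong (allFin n) (λ i _ → ∑-distrib-+ (allFin n) (λ j → C i j * + p i j) (λ j → C i j * + q i j)) ⟩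
  ΣFin n (λ i → ΣFin n (λ j → C i j * + p i j) + ΣFin n (λ j → C i j * + q i j))
    ≡⟨ ∑-distrib-+ (allFin n) (λ i → ΣFin n (λ j → C i j * + p i j)) (λ i → ΣFin n (λ j → C i j * + q i j)) ⟩
  cartanSum n p + cartanSum n q
    ∎
  where
  open ≡-Reasoning
  C = cartan n

cartanSum-zero : ∀ n → cartanSum n (λ _ _ → 0) ≡ 0ℤ
cartanSum-zero n =
  trans (∑-cong (allFin n) (λ i _ → trans (∑-cong (allFin n) (λ j _ → ℤₚ.*-zeroʳ (cartan n i j)))
                                          (∑-zero (allFin n))))
        (∑-zero (allFin n))

-- Only the entries C₀₀ = 2 and C₀₁ = C₁₀ = -1 of the first row and column are nonzero.
cartanSum-suc-suc : ∀ n (p : Fin (suc (suc n)) → Fin (suc (suc n)) → ℕ) →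
  cartanSum (suc (suc n)) p
    ≡ + 2 * + p 0F 0F - + p 0F 1F - + p 1F 0F + cartanSum (suc n) (λ i j → p (Fin.suc i) (Fin.suc j))
cartanSum-suc-suc n p = begin
  ΣFin (2+n) row
    ≡⟨ ΣFin-suc (suc n) row ⟩
  row 0F + ΣFin (suc n) (row ∘ Fin.suc)
    ≡⟨ cong₂ _+_ firstRow
                 (∑-cong (allFin (suc n)) (λ i _ → ΣFin-suc (suc n) (λ j → C (Fin.suc i) j * + p (Fin.suc i) j))) ⟩
  + 2 * + p 0F 0F + -1ℤ * + p 0F 1F + ΣFin (suc n) (λ i → column i + rest i)
    ≡⟨ cong (_+_ (+ 2 * + p 0F 0F + -1ℤ * + p 0F 1F)) (∑-distrib-+ (allFin (suc n)) column rest) ⟩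
  + 2 * + p 0F 0F + -1ℤ * + p 0F 1F + (ΣFin (suc n) column + ΣFin (suc n) rest)
    ≡⟨ cong (λ c → + 2 * + p 0F 0F + -1ℤ * + p 0F 1F + (c + ΣFin (suc n) rest)) (ΣFin-head n column (λ _ → refl)) ⟩
  + 2 * + p 0F 0F + -1ℤ * + p 0F 1F + (-1ℤ * + p 1F 0F + ΣFin (suc n) rest)
    ≡⟨ regroup (+ p 0F 0F) (+ p 0F 1F) (+ p 1F 0F) (ΣFin (suc n) rest) ⟩
  + 2 * + p 0F 0F - + p 0F 1F - + p 1F 0F + ΣFin (suc n) rest
    ∎
  where
  open ≡-Reasoning
  2+n = suc (suc n)
  C = cartan 2+n
  row : Fin 2+n → ℤ
  row i = ΣFin 2+n (λ j → C i j * + p i j)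
  column rest : Fin (suc n) → ℤ
  column i = C (Fin.suc i) 0F * + p (Fin.suc i) 0F
  rest i = ΣFin (suc n) (λ j → C (Fin.suc i) (Fin.suc j) * + p (Fin.suc i) (Fin.suc j))
  firstRow : row 0F ≡ + 2 * + p 0F 0F + -1ℤ * + p 0F 1F
  firstRow = trans (ΣFin-suc (suc n) (λ j → C 0F j * + p 0F j))
                   (cong (_+_ (+ 2 * + p 0F 0F)) (ΣFin-head n (λ j → C 0F (Fin.suc j) * + p 0F (Fin.suc j)) (λ _ → refl)))
  regroup : ∀ (a b c t : ℤ) → + 2 * a + -1ℤ * b + (-1ℤ * c + t) ≡ + 2 * a - b - c + t
  regroup = solve-∀

halfQuadratic : ∀ n → (Fin (suc n) → ℕ) → ℤ
halfQuadratic zero    x = + x 0F * + x 0F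
halfQuadratic (suc n) x = + x 0F * (+ x 0F - + x 1F) + halfQuadratic n (x ∘ Fin.suc)

cartanSum-rank1 : ∀ n (x : Fin (suc n) → ℕ) → cartanSum (suc n) (λ i j → x i ℕ.* x j) ≡ + 2 * halfQuadratic n x
cartanSum-rank1 zero    x =
  trans (ℤₚ.+-identityʳ _) (trans (ℤₚ.+-identityʳ _) (cong (_*_ (+ 2)) (ℤₚ.pos-* (x 0F) (x 0F))))
cartanSum-rank1 (suc n) x = begin
  cartanSum (suc (suc n)) (λ i j → x i ℕ.* x j)
    ≡⟨ cartanSum-suc-suc n (λ i j → x i ℕ.* x j) ⟩
  + 2 * + (a ℕ.* a) - + (a ℕ.* b) - + (b ℕ.* a) + cartanSum (suc n) (λ i j → x (Fin.suc i) ℕ.* x (Fin.suc j))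
    ≡⟨ cong₂ _+_ (cong₂ _-_ (cong₂ _-_ (cong (_*_ (+ 2)) (ℤₚ.pos-* a a)) (ℤₚ.pos-* a b)) (ℤₚ.pos-* b a))
                 (cartanSum-rank1 n (x ∘ Fin.suc)) ⟩
  + 2 * (+ a * + a) - + a * + b - + b * + a + + 2 * halfQuadratic n (x ∘ Fin.suc)
    ≡⟨ factor (+ a) (+ b) (halfQuadratic n (x ∘ Fin.suc)) ⟩
  + 2 * halfQuadratic (suc n) x
    ∎
  where
  open ≡-Reasoning
  a = x 0F
  b = x 1F
  factor : ∀ a b h → + 2 * (a * a) - a * b - b * a + + 2 * h ≡ + 2 * (a * (a - b) + h)
  factor = solve-∀

square-nonNeg : ∀ t → 0ℤ ℤ.≤ t * t
square-nonNeg (+ n)    = subst (0ℤ ℤ.≤_) (ℤₚ.pos-* n n) (ℤ.+≤+ z≤n)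
square-nonNeg ℤ.-[1+ n ] = ℤ.+≤+ z≤n

≤-+-nonNeg : ∀ i {j} → 0ℤ ℤ.≤ j → i ℤ.≤ i + j
≤-+-nonNeg i {j} 0≤j = subst (ℤ._≤ i + j) (ℤₚ.+-identityʳ i) (ℤₚ.+-monoʳ-≤ i 0≤j)

-- In fact 2 · halfQuadratic n x = x₀² + (x₀ - x₁)² + … + (xₙ₋₁ - xₙ)² + xₙ²; the induction only needs ≥ x₀².
halfQuadratic-lower : ∀ n (x : Fin (suc n) → ℕ) → + x 0F * + x 0F ℤ.≤ + 2 * halfQuadratic n x
halfQuadratic-lower zero    x = subst (+ x 0F * + x 0F ℤ.≤_) (double (+ x 0F * + x 0F))
                                      (≤-+-nonNeg (+ x 0F * + x 0F) (square-nonNeg (+ x 0F)))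
  where
  double : ∀ t → t + t ≡ + 2 * t
  double = solve-∀
halfQuadratic-lower (suc n) x = begin
  a * a                                         ≤⟨ ≤-+-nonNeg (a * a) (square-nonNeg (a - b)) ⟩
  a * a + (a - b) * (a - b)                     ≤⟨ ≤-+-nonNeg (a * a + (a - b) * (a - b))
                                                     (ℤₚ.i≤j⇒0≤j-i (halfQuadratic-lower n (x ∘ Fin.suc))) ⟩
  a * a + (a - b) * (a - b) + (+ 2 * h - b * b) ≡⟨ complete-square a b h ⟩
  + 2 * halfQuadratic (suc n) x                 ∎
  where
  open ℤₚ.≤-Reasoning
  a = + x 0F
  b = + x 1F
  h = halfQuadratic n (x ∘ Fin.suc)
  complete-square : ∀ a b h → a * a + (a - b) * (a - b) + (+ 2 * h - b * b) ≡ + 2 * (a * (a - b) + h)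
  complete-square = solve-∀

halfQuadratic-nonNeg : ∀ n x → 0ℤ ℤ.≤ halfQuadratic n x
halfQuadratic-nonNeg n x =
  ℤₚ.*-cancelˡ-≤-pos 0ℤ (halfQuadratic n x) (+ 2) (ℤₚ.≤-trans (square-nonNeg (+ x 0F)) (halfQuadratic-lower n x))

IsDouble : ℤ → Set
IsDouble t = Σ[ h ∈ ℕ ] t ≡ + (h ℕ.* 2)

half-of-double : ∀ {t} h → t ≡ + (h ℕ.* 2) → ∣ t ∣ / 2 ≡ h
half-of-double h t≡2h = trans (cong (λ s → ∣ s ∣ / 2) t≡2h) (m*n/n≡m h 2)

double-+ : ∀ {s t} → IsDouble s → IsDouble t → IsDouble (s + t)
double-+ (g , s≡2g) (h , t≡2h) =
  g ℕ.+ h ,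
  trans (cong₂ _+_ s≡2g t≡2h) (trans (sym (ℤₚ.pos-+ (g ℕ.* 2) (h ℕ.* 2))) (cong +_ (sym (ℕₚ.*-distribʳ-+ 2 g h))))

cartanSum-rank1-double : ∀ n (x : Fin n → ℕ) → IsDouble (cartanSum n (λ i j → x i ℕ.* x j))
cartanSum-rank1-double zero    x = 0 , refl
cartanSum-rank1-double (suc n) x = ∣ h ∣ , (begin
  cartanSum (suc n) (λ i j → x i ℕ.* x j)  ≡⟨ cartanSum-rank1 n x ⟩
  + 2 * h                                  ≡⟨ ℤₚ.*-comm (+ 2) h ⟩
  h * + 2                                  ≡⟨ cong (_* + 2) (ℤₚ.0≤i⇒+∣i∣≡i (halfQuadratic-nonNeg n x)) ⟨
  + ∣ h ∣ * + 2                            ≡⟨ ℤₚ.pos-* ∣ h ∣ 2 ⟨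
  + (∣ h ∣ ℕ.* 2)                          ∎)
  where
  open ≡-Reasoning
  h = halfQuadratic n x

cartanSum-gram-double : ∀ n N (u : Fin n → ℕ → ℕ) →
                        IsDouble (cartanSum n (λ i j → sumℕ (applyUpTo (λ k → u i k ℕ.* u j k) N)))
cartanSum-gram-double n zero    u = 0 , cartanSum-zero n
cartanSum-gram-double n (suc N) u =
  subst IsDouble (sym (cartanSum-+ n (λ i j → u i 0 ℕ.* u j 0) rest))
        (double-+ (cartanSum-rank1-double n (λ i → u i 0)) (cartanSum-gram-double n N (λ i k → u i (suc k))))
  where
  rest : Fin n → Fin n → ℕ
  rest i j = sumℕ (applyUpTo (λ k → u i (suc k) ℕ.* u j (suc k)) N)

halfCartanForm-cong : ∀ n {p q : Fin n → Fin n → ℕ} → (∀ i j → p i j ≡ q i j) →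
                      halfCartanForm n p ≡ halfCartanForm n q
halfCartanForm-cong n p≡q = cong (λ t → ∣ t ∣ / 2) (cartanSum-cong n p≡q)

halfCartanForm-+ : ∀ n {P Q R : Fin n → Fin n → ℕ} → (∀ i j → P i j ≡ Q i j ℕ.+ R i j) →
                   IsDouble (cartanSum n Q) → IsDouble (cartanSum n R) →
                   halfCartanForm n P ≡ halfCartanForm n Q ℕ.+ halfCartanForm n R
halfCartanForm-+ n {P} {Q} {R} P≡Q+R (g , Q≡2g) (h , R≡2h) = begin
  ∣ cartanSum n P ∣ / 2
    ≡⟨ half-of-double (g ℕ.+ h) (trans P≡Q+R′ (proj₂ (double-+ (g , Q≡2g) (h , R≡2h)))) ⟩
  g ℕ.+ h
    ≡⟨ cong₂ ℕ._+_ (half-of-double g Q≡2g) (half-of-double h R≡2h) ⟨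
  ∣ cartanSum n Q ∣ / 2 ℕ.+ ∣ cartanSum n R ∣ / 2
    ∎
  where
  open ≡-Reasoning
  P≡Q+R′ : cartanSum n P ≡ cartanSum n Q + cartanSum n R
  P≡Q+R′ = trans (cartanSum-cong n P≡Q+R) (cartanSum-+ n Q R)

-- Adding and removing a first column

addColumn : ℕ → Partition → Partition
addColumn r μ = map suc μ ++ replicate (r ∸ len μ) 1

removeColumn : Partition → Partition
removeColumn (suc (suc x) ∷ xs) = suc x ∷ removeColumn xs
removeColumn _                  = []

conjAt : Partition → ℕ → ℕ
conjAt λp k = count (λ x → suc k ≤ᵇ x) λp

count-++ : ∀ p xs ys → count p (xs ++ ys) ≡ count p xs ℕ.+ count p ys
count-++ p []       ys = refl
count-++ p (x ∷ xs) ys with p x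
... | true  = cong suc (count-++ p xs ys)
... | false = count-++ p xs ys

count-map-suc : ∀ p xs → count p (map suc xs) ≡ count (p ∘ suc) xs
count-map-suc p []       = refl
count-map-suc p (x ∷ xs) with p (suc x)
... | true  = cong suc (count-map-suc p xs)
... | false = count-map-suc p xs

count-all-true : ∀ p {xs} → All (λ x → p x ≡ true) xs → count p xs ≡ length xs
count-all-true p []                = refl
count-all-true p (px≡true ∷ pxs) rewrite px≡true = cong suc (count-all-true p pxs)

count-all-false : ∀ p {xs} → All (λ x → p x ≡ false) xs → count p xs ≡ 0
count-all-false p []                = refl
count-all-false p (px≡false ∷ pxs) rewrite px≡false = count-all-false p pxs

count-addColumn : ∀ p r μ → count p (addColumn r μ) ≡ count (p ∘ suc) μ ℕ.+ count p (replicate (r ∸ len μ) 1)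
count-addColumn p r μ = trans (count-++ p (map suc μ) _) (cong (ℕ._+ count p (replicate (r ∸ len μ) 1)) (count-map-suc p μ))

length-addColumn : ∀ r μ → len μ ≤ r → len (addColumn r μ) ≡ r
length-addColumn r μ μ≤r = begin
  length (map suc μ ++ replicate (r ∸ len μ) 1)
    ≡⟨ Listₚ.length-++ (map suc μ) ⟩
  length (map suc μ) ℕ.+ length (replicate (r ∸ len μ) 1)
    ≡⟨ cong₂ ℕ._+_ (Listₚ.length-map suc μ) (Listₚ.length-replicate (r ∸ len μ)) ⟩
  len μ ℕ.+ (r ∸ len μ)
    ≡⟨ ℕₚ.m+[n∸m]≡n μ≤r ⟩
  r
    ∎
  where open ≡-Reasoning

size-addColumn : ∀ r μ → len μ ≤ r → size (addColumn r μ) ≡ size μ ℕ.+ r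
size-addColumn r μ μ≤r = begin
  sumℕ (map suc μ ++ replicate (r ∸ len μ) 1)
    ≡⟨ sum-++ (map suc μ) _ ⟩
  sumℕ (map suc μ) ℕ.+ sumℕ (replicate (r ∸ len μ) 1)
    ≡⟨ cong₂ ℕ._+_ (sumℕ-map-suc μ) (sumℕ-ones (r ∸ len μ)) ⟩
  size μ ℕ.+ len μ ℕ.+ (r ∸ len μ)
    ≡⟨ ℕₚ.+-assoc (size μ) (len μ) _ ⟩
  size μ ℕ.+ (len μ ℕ.+ (r ∸ len μ))
    ≡⟨ cong (size μ ℕ.+_) (ℕₚ.m+[n∸m]≡n μ≤r) ⟩
  size μ ℕ.+ r
    ∎
  where
  open ≡-Reasoning
  sumℕ-map-suc : ∀ xs → sumℕ (map suc xs) ≡ sumℕ xs ℕ.+ length xs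
  sumℕ-map-suc []       = refl
  sumℕ-map-suc (x ∷ xs) = trans (cong (λ t → suc x ℕ.+ t) (sumℕ-map-suc xs)) (shuffle x (sumℕ xs) (length xs))
    where
    shuffle : ∀ x s m → suc x ℕ.+ (s ℕ.+ m) ≡ x ℕ.+ s ℕ.+ suc m
    shuffle x s m = trans (cong suc (sym (ℕₚ.+-assoc x s m))) (sym (ℕₚ.+-suc (x ℕ.+ s) m))
  sumℕ-ones : ∀ m → sumℕ (replicate m 1) ≡ m
  sumℕ-ones zero    = refl
  sumℕ-ones (suc m) = cong suc (sumℕ-ones m)

size≤size-addColumn : ∀ r μ → len μ ≤ r → size μ ≤ size (addColumn r μ)
size≤size-addColumn r μ μ≤r = subst (size μ ≤_) (sym (size-addColumn r μ μ≤r)) (ℕₚ.m≤m+n (size μ) r)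

conjAt-addColumn-zero : ∀ r μ → len μ ≤ r → conjAt (addColumn r μ) 0 ≡ r
conjAt-addColumn-zero r μ μ≤r = begin
  conjAt (addColumn r μ) 0
    ≡⟨ count-addColumn (1 ≤ᵇ_) r μ ⟩
  count (λ _ → true) μ ℕ.+ count (1 ≤ᵇ_) (replicate (r ∸ len μ) 1)
    ≡⟨ cong₂ ℕ._+_ (count-all-true _ (All.universal (λ _ → refl) μ))
                   (count-all-true _ (Allₚ.replicate⁺ (r ∸ len μ) refl)) ⟩
  len μ ℕ.+ length (replicate (r ∸ len μ) 1)
    ≡⟨ cong (len μ ℕ.+_) (Listₚ.length-replicate (r ∸ len μ)) ⟩
  len μ ℕ.+ (r ∸ len μ)
    ≡⟨ ℕₚ.m+[n∸m]≡n μ≤r ⟩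
  r
    ∎
  where open ≡-Reasoning

conjAt-addColumn-suc : ∀ r μ k → conjAt (addColumn r μ) (suc k) ≡ conjAt μ k
conjAt-addColumn-suc r μ k = trans (count-addColumn (suc (suc k) ≤ᵇ_) r μ)
  (trans (cong (conjAt μ k ℕ.+_) (count-all-false _ (Allₚ.replicate⁺ (r ∸ len μ) refl))) (ℕₚ.+-identityʳ _))

mult-addColumn-one : ∀ r μ → All (0 <_) μ → mult 1 (addColumn r μ) ≡ r ∸ len μ
mult-addColumn-one r μ μ>0 = begin
  mult 1 (addColumn r μ)
    ≡⟨ count-addColumn (ℕ._≡ᵇ 1) r μ ⟩
  count (λ x → suc x ℕ.≡ᵇ 1) μ ℕ.+ count (ℕ._≡ᵇ 1) (replicate (r ∸ len μ) 1)
    ≡⟨ cong₂ ℕ._+_ (count-all-false _ (All.map suc≢1 μ>0))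
                   (count-all-true _ (Allₚ.replicate⁺ (r ∸ len μ) refl)) ⟩
  length (replicate (r ∸ len μ) 1)
    ≡⟨ Listₚ.length-replicate (r ∸ len μ) ⟩
  r ∸ len μ
    ∎
  where
  open ≡-Reasoning
  suc≢1 : ∀ {x} → 0 < x → (suc x ℕ.≡ᵇ 1) ≡ false
  suc≢1 (s≤s _) = refl

mult-addColumn-suc : ∀ r μ i → mult (suc (suc i)) (addColumn r μ) ≡ mult (suc i) μ
mult-addColumn-suc r μ i = trans (count-addColumn (ℕ._≡ᵇ suc (suc i)) r μ)
  (trans (cong (mult (suc i) μ ℕ.+_) (count-all-false _ (Allₚ.replicate⁺ (r ∸ len μ) refl))) (ℕₚ.+-identityʳ _))

conjAt-large : ∀ λp k → size λp ≤ k → conjAt λp k ≡ 0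
conjAt-large []       k _ = refl
conjAt-large (x ∷ λp) k x+|λp|≤k
  rewrite dec-false (suc k ℕ.≤? x) (ℕₚ.≤⇒≯ (ℕₚ.m+n≤o⇒m≤o x x+|λp|≤k))
  = conjAt-large λp k (ℕₚ.m+n≤o⇒n≤o x x+|λp|≤k)

mult-large : ∀ λp i → size λp ≤ i → mult (suc i) λp ≡ 0
mult-large []       i _ = refl
mult-large (x ∷ λp) i x+|λp|≤i
  rewrite dec-false (x ℕ.≟ suc i) (ℕₚ.<⇒≢ (s≤s (ℕₚ.m+n≤o⇒m≤o x x+|λp|≤i)))
  = mult-large λp i (ℕₚ.m+n≤o⇒n≤o x x+|λp|≤i)

sumℕ-zero : ∀ N {h} → (∀ k → h k ≡ 0) → sumℕ (applyUpTo h N) ≡ 0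
sumℕ-zero zero    h≡0 = refl
sumℕ-zero (suc N) h≡0 rewrite h≡0 0 = sumℕ-zero N (h≡0 ∘ suc)

inner-applyUpTo : ∀ A B N (f g : ℕ → ℕ) → A ≤ N → (∀ k → A ≤ k → f k ≡ 0) → (∀ k → B ≤ k → g k ≡ 0) →
                  inner (applyUpTo f A) (applyUpTo g B) ≡ sumℕ (applyUpTo (λ k → f k ℕ.* g k) N)
inner-applyUpTo zero    B       N       f g _         f≡0 g≡0 = sym (sumℕ-zero N (λ k → cong (ℕ._* g k) (f≡0 k z≤n)))
inner-applyUpTo (suc A) zero    N       f g _         f≡0 g≡0 =
  sym (sumℕ-zero N (λ k → trans (cong (f k ℕ.*_) (g≡0 k z≤n)) (ℕₚ.*-zeroʳ (f k))))
inner-applyUpTo (suc A) (suc B) (suc N) f g (s≤s A≤N) f≡0 g≡0 =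
  cong (f 0 ℕ.* g 0 ℕ.+_)
       (inner-applyUpTo A B N (f ∘ suc) (g ∘ suc) A≤N (λ k → f≡0 (suc k) ∘ s≤s) (λ k → g≡0 (suc k) ∘ s≤s))

inner-conj : ∀ λp μ N → size λp ≤ N →
             inner (conj λp) (conj μ) ≡ sumℕ (applyUpTo (λ k → conjAt λp k ℕ.* conjAt μ k) N)
inner-conj λp μ N |λp|≤N =
  inner-applyUpTo (size λp) (size μ) N (conjAt λp) (conjAt μ) |λp|≤N (conjAt-large λp) (conjAt-large μ)

applyUpTo-cong : ∀ {A : Set} {f g : ℕ → A} → f ≗ g → ∀ n → applyUpTo f n ≡ applyUpTo g n
applyUpTo-cong {f = f} {g} f≗g n =
  trans (sym (Listₚ.map-upTo f n)) (trans (Listₚ.map-cong f≗g (upTo n)) (Listₚ.map-upTo g n))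

inner-conj-addColumn : ∀ r μ s ν → len μ ≤ r → len ν ≤ s →
  inner (conj (addColumn r μ)) (conj (addColumn s ν)) ≡ r ℕ.* s ℕ.+ inner (conj μ) (conj ν)
inner-conj-addColumn r μ s ν μ≤r ν≤s = begin
  inner (conj λp) (conj κ)
    ≡⟨ inner-conj λp κ (suc S) (ℕₚ.n≤1+n S) ⟩
  conjAt λp 0 ℕ.* conjAt κ 0 ℕ.+ sumℕ (applyUpTo (λ k → conjAt λp (suc k) ℕ.* conjAt κ (suc k)) S)
    ≡⟨ cong₂ ℕ._+_ (cong₂ ℕ._*_ (conjAt-addColumn-zero r μ μ≤r) (conjAt-addColumn-zero s ν ν≤s))
                   (cong sumℕ (applyUpTo-cong (λ k → cong₂ ℕ._*_ (conjAt-addColumn-suc r μ k)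
                                                                 (conjAt-addColumn-suc s ν k)) S)) ⟩
  r ℕ.* s ℕ.+ sumℕ (applyUpTo (λ k → conjAt μ k ℕ.* conjAt ν k) S)
    ≡⟨ cong (r ℕ.* s ℕ.+_) (inner-conj μ ν S (size≤size-addColumn r μ μ≤r)) ⟨
  r ℕ.* s ℕ.+ inner (conj μ) (conj ν)
    ∎
  where
  open ≡-Reasoning
  λp = addColumn r μ
  κ = addColumn s ν
  S = size λp

prodS-trailing-ones : ∀ (g : ℕ → QS) a m → a ≤ m → (∀ i → a ≤ i → g i ≡ oneS) →
                      prodS (applyUpTo g m) ≗ prodS (applyUpTo g a)
prodS-trailing-ones g zero    zero    _         _   = λ _ → refl
prodS-trailing-ones g zero    (suc m) _         g≡1 = begin
  g 0 ⊗ prodS (applyUpTo (g ∘ suc) m)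
    ≈⟨ ⊗-cong (λ k → cong (λ f → f k) (g≡1 0 z≤n))
              (prodS-trailing-ones (g ∘ suc) 0 m z≤n (λ i _ → g≡1 (suc i) z≤n)) ⟩
  oneS ⊗ oneS
    ≈⟨ oneS-⊗ oneS ⟩
  oneS
    ∎
  where open ≗-Reasoning
prodS-trailing-ones g (suc a) (suc m) (s≤s a≤m) g≡1 =
  ⊗-congˡ (g 0) (prodS-trailing-ones (g ∘ suc) a m a≤m (λ i → g≡1 (suc i) ∘ s≤s))

bPoly-addColumn : ∀ r μ → All (0 <_) μ → len μ ≤ r → bPoly (addColumn r μ) ≗ poch (r ∸ len μ) ⊗ bPoly μ
bPoly-addColumn r μ μ>0 μ≤r = begin
  prodS (applyUpTo gλ S)
    ≈⟨ prodS-trailing-ones gλ S (suc S) (ℕₚ.n≤1+n S) (λ i S≤i → cong poch (mult-large λp i S≤i)) ⟨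
  gλ 0 ⊗ prodS (applyUpTo (gλ ∘ suc) S)
    ≈⟨ ⊗-cong (λ k → cong (λ m → poch m k) (mult-addColumn-one r μ μ>0))
              (λ k → cong (λ fs → prodS fs k) (applyUpTo-cong (λ i → cong poch (mult-addColumn-suc r μ i)) S)) ⟩
  poch (r ∸ len μ) ⊗ prodS (applyUpTo gμ S)
    ≈⟨ ⊗-congˡ (poch (r ∸ len μ)) (prodS-trailing-ones gμ (size μ) S (size≤size-addColumn r μ μ≤r)
                                                        (λ i |μ|≤i → cong poch (mult-large μ i |μ|≤i))) ⟩
  poch (r ∸ len μ) ⊗ bPoly μ
    ∎
  where
  open ≗-Reasoning
  λp = addColumn r μ
  S = size λp
  gλ gμ : ℕ → QS
  gλ i = poch (mult (suc i) λp)
  gμ i = poch (mult (suc i) μ)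

IsPartition : Partition → Set
IsPartition λp = T (isPartitionB λp)

T-∧-mapʳ : ∀ {a b c} → (T b → T c) → T (a ∧ b) → T (a ∧ c)
T-∧-mapʳ {true} f = f

isPartition-tail : ∀ x xs → IsPartition (x ∷ xs) → IsPartition xs
isPartition-tail x []       _ = tt
isPartition-tail x (y ∷ xs) p = proj₂ (Equivalence.to Boolₚ.T-∧ p)

¬IsPartition-0∷ : ∀ xs → ¬ IsPartition (0 ∷ xs)
¬IsPartition-0∷ (zero ∷ xs) p = ¬IsPartition-0∷ xs p

isPartition-head>0 : ∀ x xs → IsPartition (x ∷ xs) → 0 < x
isPartition-head>0 zero    xs p = ⊥-elim (¬IsPartition-0∷ xs p)
isPartition-head>0 (suc x) xs _ = s≤s z≤n

isPartition⇒positive : ∀ λp → IsPartition λp → All (0 <_) λp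
isPartition⇒positive []       _ = []
isPartition⇒positive (x ∷ xs) p =
  isPartition-head>0 x xs p ∷ isPartition⇒positive xs (isPartition-tail x xs p)

isPartition-ones : ∀ m → IsPartition (replicate m 1)
isPartition-ones zero          = tt
isPartition-ones (suc zero)    = tt
isPartition-ones (suc (suc m)) = isPartition-ones (suc m)

isPartition-addColumn : ∀ r μ → IsPartition μ → IsPartition (addColumn r μ)
isPartition-addColumn r μ = go (r ∸ len μ) μ
  where
  go : ∀ m μ → IsPartition μ → IsPartition (map suc μ ++ replicate m 1)
  go m       []               _ = isPartition-ones m
  go zero    (x ∷ [])         _ = tt
  go (suc m) (x ∷ [])         _ = isPartition-ones (suc m)
  go m       (x ∷ zero ∷ xs)  p = ⊥-elim (¬IsPartition-0∷ xs p)
  go m       (x ∷ suc y ∷ xs) p = T-∧-mapʳ (go m (suc y ∷ xs)) p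

isPartition-removeColumn : ∀ λp → IsPartition λp → IsPartition (removeColumn λp)
isPartition-removeColumn []                               _ = tt
isPartition-removeColumn (zero ∷ xs)                      p = ⊥-elim (¬IsPartition-0∷ xs p)
isPartition-removeColumn (suc zero ∷ xs)                  _ = tt
isPartition-removeColumn (suc (suc x) ∷ [])               _ = tt
isPartition-removeColumn (suc (suc x) ∷ zero ∷ xs)        p = ⊥-elim (¬IsPartition-0∷ xs p)
isPartition-removeColumn (suc (suc x) ∷ suc zero ∷ xs)    _ = tt
isPartition-removeColumn (suc (suc x) ∷ suc (suc y) ∷ xs) p = T-∧-mapʳ (isPartition-removeColumn (suc (suc y) ∷ xs)) p

length-removeColumn : ∀ λp → len (removeColumn λp) ≤ len λp
length-removeColumn []                 = z≤n
length-removeColumn (zero ∷ xs)        = z≤n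
length-removeColumn (suc zero ∷ xs)    = z≤n
length-removeColumn (suc (suc x) ∷ xs) = s≤s (length-removeColumn xs)

removeColumn-addColumn : ∀ r μ → All (0 <_) μ → removeColumn (addColumn r μ) ≡ μ
removeColumn-addColumn r μ = go (r ∸ len μ) μ
  where
  go : ∀ m μ → All (0 <_) μ → removeColumn (map suc μ ++ replicate m 1) ≡ μ
  go zero    []          []           = refl
  go (suc m) []          []           = refl
  go m       (suc x ∷ μ) (_ ∷ μ>0)    = cong (suc x ∷_) (go m μ μ>0)

addColumn-removeColumn : ∀ λp → IsPartition λp → addColumn (len λp) (removeColumn λp) ≡ λp
addColumn-removeColumn []                 _ = refl
addColumn-removeColumn (zero ∷ xs)        p = ⊥-elim (¬IsPartition-0∷ xs p)
addColumn-removeColumn (suc zero ∷ xs)    p = cong (1 ∷_) (sym (ones xs p))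
  where
  ones : ∀ xs → IsPartition (1 ∷ xs) → xs ≡ replicate (len xs) 1
  ones []                 _ = refl
  ones (zero ∷ xs)        p = ⊥-elim (¬IsPartition-0∷ xs p)
  ones (suc zero ∷ xs)    p = cong (1 ∷_) (ones xs p)
addColumn-removeColumn (suc (suc x) ∷ xs) p =
  cong (suc (suc x) ∷_) (addColumn-removeColumn xs (isPartition-tail _ xs p))

-- Enumerating partitions

Unique-concatMap : ∀ {A B : Set} (f : A → List B) (key : B → A) → (∀ x y → y ∈ f x → key y ≡ x) →
                   (∀ x → Unique (f x)) → ∀ {xs} → Unique xs → Unique (concatMap f xs)
Unique-concatMap f key keyed f-unique xs-unique =
  Uniqueₚ.concat⁺ (Allₚ.map⁺ (All.universal f-unique _)) (AllPairsₚ.map⁺ (AllPairs.map disjoint xs-unique))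
  where
  disjoint : ∀ {x x′} → x ≢ x′ → ∀ {v} → ¬ (v ∈ f x × v ∈ f x′)
  disjoint x≢x′ (v∈fx , v∈fx′) = x≢x′ (trans (sym (keyed _ _ v∈fx)) (keyed _ _ v∈fx′))

Unique-map-injectiveOn : ∀ {A B : Set} (f : A → B) {xs} → (∀ {x y} → x ∈ xs → y ∈ xs → f x ≡ f y → x ≡ y) →
                         Unique xs → Unique (map f xs)
Unique-map-injectiveOn f          injective []            = []
Unique-map-injectiveOn f {x ∷ xs} injective (x∉xs ∷ xs!) =
  Allₚ.map⁺ (All.tabulate (λ y∈xs fx≡fy → All.lookup x∉xs y∈xs (injective (here refl) (there y∈xs) fx≡fy))) ∷
  Unique-map-injectiveOn f (λ x∈ y∈ → injective (there x∈) (there y∈)) xs!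

listsUpTo-complete : ∀ L B l → len l ≤ L → All (λ x → 0 < x × x ≤ B) l → l ∈ listsUpTo L B
listsUpTo-complete zero    B []      _         _ = here refl
listsUpTo-complete (suc L) B []      _         _ = here refl
listsUpTo-complete (suc L) B (suc x ∷ l) (s≤s l≤L) ((_ , x<B) ∷ l-bounded) =
  there (∈ₚ.∈-concatMap⁺ (λ y → map (y ∷_) (listsUpTo L B)) {xs = applyUpTo suc B}
          (Any.map (λ { refl → ∈ₚ.∈-map⁺ (suc x ∷_) (listsUpTo-complete L B l l≤L l-bounded) })
                   (∈ₚ.∈-applyUpTo⁺ suc x<B)))

listsUpTo-unique : ∀ L B → Unique (listsUpTo L B)
listsUpTo-unique zero    B = [] ∷ []
listsUpTo-unique (suc L) B =
  All.tabulate nonEmpty ∷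
  Unique-concatMap (λ x → map (x ∷_) (listsUpTo L B)) head headed
    (λ x → Uniqueₚ.map⁺ Listₚ.∷-injectiveʳ (listsUpTo-unique L B))
    (Uniqueₚ.applyUpTo⁺₁ suc B (λ i<j _ → ℕₚ.<⇒≢ i<j ∘ ℕₚ.suc-injective))
  where
  head : List ℕ → ℕ
  head []      = 0
  head (x ∷ _) = x
  headed : ∀ x y → y ∈ map (x ∷_) (listsUpTo L B) → head y ≡ x
  headed x y y∈ with ∈ₚ.∈-map⁻ (x ∷_) y∈
  ... | _ , _ , refl = refl
  nonEmpty : ∀ {y} → y ∈ concatMap (λ x → map (x ∷_) (listsUpTo L B)) (applyUpTo suc B) → [] ≢ y
  nonEmpty y∈ with Any.satisfied (∈ₚ.∈-concatMap⁻ (λ x → map (x ∷_) (listsUpTo L B)) {xs = applyUpTo suc B} y∈)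
  ... | x , y∈x∷ with ∈ₚ.∈-map⁻ (x ∷_) y∈x∷
  ...   | _ , _ , refl = λ ()

length≤size : ∀ λp → All (0 <_) λp → len λp ≤ size λp
length≤size []       []          = z≤n
length≤size (x ∷ λp) (x>0 ∷ λp>0) = ℕₚ.+-mono-≤ x>0 (length≤size λp λp>0)

parts≤size : ∀ λp → All (_≤ size λp) λp
parts≤size []       = []
parts≤size (x ∷ λp) =
  ℕₚ.m≤m+n x (size λp) ∷ All.map (λ y≤ → ℕₚ.≤-trans y≤ (ℕₚ.m≤n+m (size λp) x)) (parts≤size λp)

isPartitionOf? : ∀ m → Decidable (λ l → T (isPartitionB l ∧ (size l ℕ.≡ᵇ m)))
isPartitionOf? m l = T? (isPartitionB l ∧ (size l ℕ.≡ᵇ m))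

∈-partitions⁺ : ∀ {m λp} → IsPartition λp → size λp ≡ m → λp ∈ partitions m
∈-partitions⁺ {λp = λp} p refl =
  ∈ₚ.∈-filter⁺ (isPartitionOf? (size λp))
    (listsUpTo-complete (size λp) (size λp) λp (length≤size λp λp>0) (All.zip (λp>0 , parts≤size λp)))
    (Equivalence.from Boolₚ.T-∧ (p , ℕₚ.≡⇒≡ᵇ (size λp) (size λp) refl))
  where
  λp>0 = isPartition⇒positive λp p

∈-partitions⁻ : ∀ m {λp} → λp ∈ partitions m → IsPartition λp × size λp ≡ m
∈-partitions⁻ m {λp} λp∈
  with Equivalence.to Boolₚ.T-∧ (proj₂ (∈ₚ.∈-filter⁻ (isPartitionOf? m) {xs = listsUpTo m m} λp∈))
... | p , |λp|≡m = p , ℕₚ.≡ᵇ⇒≡ (size λp) m |λp|≡m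

partitions-unique : ∀ m → Unique (partitions m)
partitions-unique m = Uniqueₚ.filter⁺ (isPartitionOf? m) (listsUpTo-unique m m)

pairs : ∀ {A B : Set} → List A → (A → List B) → List (A × B)
pairs xs K = concatMap (λ a → map (a ,_) (K a)) xs

record IsColumnSplit (M d r : ℕ) (μ : Partition) : Set where
  field
    r≤M           : r ≤ M
    r≤d           : r ≤ d
    μ-isPartition : IsPartition μ
    size-μ        : size μ ≡ d ∸ r
    len-μ≤r       : len μ ≤ r

ValidSplit : ℕ → ℕ × Partition → Set
ValidSplit d (r , μ) = r ≤ d × len μ ≤ r

validSplit? : ∀ d → Decidable (ValidSplit d)
validSplit? d (r , μ) = r ℕ.≤? d ×-dec len μ ℕ.≤? r

columnSplits : ℕ → ℕ → List (ℕ × Partition)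
columnSplits M d = filter (validSplit? d) (pairs (upTo (suc M)) (λ r → partitions (d ∸ r)))

shortPartitions : ℕ → ℕ → List Partition
shortPartitions M d = filter (λ λp → len λp ℕ.≤? M) (partitions d)

∈-columnSplits⁻ : ∀ M d {r μ} → (r , μ) ∈ columnSplits M d → IsColumnSplit M d r μ
∈-columnSplits⁻ M d rμ∈ with ∈ₚ.∈-filter⁻ (validSplit? d) rμ∈
... | rμ∈pairs , r≤d , len-μ≤r
  with find (∈ₚ.∈-concatMap⁻ (λ a → map (a ,_) (partitions (d ∸ a))) {xs = upTo (suc M)} rμ∈pairs)
... | r , r∈upTo , rμ∈map with ∈ₚ.∈-map⁻ (r ,_) rμ∈map
... | μ , μ∈partitions , refl = record
  { r≤M           = ℕₚ.≤-pred (∈ₚ.∈-upTo⁻ r∈upTo)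
  ; r≤d           = r≤d
  ; μ-isPartition = proj₁ (∈-partitions⁻ (d ∸ r) μ∈partitions)
  ; size-μ        = proj₂ (∈-partitions⁻ (d ∸ r) μ∈partitions)
  ; len-μ≤r       = len-μ≤r
  }

∈-columnSplits⁺ : ∀ M d {r μ} → IsColumnSplit M d r μ → (r , μ) ∈ columnSplits M d
∈-columnSplits⁺ M d {r} {μ} split =
  ∈ₚ.∈-filter⁺ (validSplit? d)
    (∈ₚ.∈-concatMap⁺ (λ a → map (a ,_) (partitions (d ∸ a))) {xs = upTo (suc M)}
      (lose (∈ₚ.∈-upTo⁺ (s≤s r≤M)) (∈ₚ.∈-map⁺ (r ,_) (∈-partitions⁺ μ-isPartition size-μ))))
    (r≤d , len-μ≤r)
  where open IsColumnSplit split

columnSplits-unique : ∀ M d → Unique (columnSplits M d)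
columnSplits-unique M d =
  Uniqueₚ.filter⁺ (validSplit? d)
    (Unique-concatMap (λ a → map (a ,_) (partitions (d ∸ a))) proj₁ first
      (λ a → Uniqueₚ.map⁺ (λ { refl → refl }) (partitions-unique (d ∸ a))) (Uniqueₚ.upTo⁺ (suc M)))
  where
  first : ∀ a p → p ∈ map (a ,_) (partitions (d ∸ a)) → proj₁ p ≡ a
  first a p p∈ with ∈ₚ.∈-map⁻ (a ,_) p∈
  ... | _ , _ , refl = refl

addColumn-injectiveOn : ∀ M d {x y} → x ∈ columnSplits M d → y ∈ columnSplits M d →
                        uncurry addColumn x ≡ uncurry addColumn y → x ≡ y
addColumn-injectiveOn M d {r , μ} {s , ν} x∈ y∈ eq = cong₂ _,_ r≡s μ≡ν
  where
  module X = IsColumnSplit (∈-columnSplits⁻ M d x∈)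
  module Y = IsColumnSplit (∈-columnSplits⁻ M d y∈)
  r≡s : r ≡ s
  r≡s = trans (sym (length-addColumn r μ X.len-μ≤r)) (trans (cong len eq) (length-addColumn s ν Y.len-μ≤r))
  μ≡ν : μ ≡ ν
  μ≡ν = trans (sym (removeColumn-addColumn r μ (isPartition⇒positive μ X.μ-isPartition)))
              (trans (cong removeColumn eq) (removeColumn-addColumn s ν (isPartition⇒positive ν Y.μ-isPartition)))

addColumn-∈-shortPartitions : ∀ M d {r μ} → (r , μ) ∈ columnSplits M d → addColumn r μ ∈ shortPartitions M d
addColumn-∈-shortPartitions M d {r} {μ} rμ∈ =
  ∈ₚ.∈-filter⁺ (λ λp → len λp ℕ.≤? M)
    (∈-partitions⁺ (isPartition-addColumn r μ μ-isPartition)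
                   (trans (size-addColumn r μ len-μ≤r) (trans (cong (ℕ._+ r) size-μ) (ℕₚ.m∸n+n≡m r≤d))))
    (subst (_≤ M) (sym (length-addColumn r μ len-μ≤r)) r≤M)
  where open IsColumnSplit (∈-columnSplits⁻ M d rμ∈)

removeColumn-∈-columnSplits : ∀ M d {λp} → λp ∈ shortPartitions M d → (len λp , removeColumn λp) ∈ columnSplits M d
removeColumn-∈-columnSplits M d {λp} λp∈ with ∈ₚ.∈-filter⁻ (λ λp → len λp ℕ.≤? M) λp∈
... | λp∈partitions , len≤M with ∈-partitions⁻ d λp∈partitions
... | λp-isPartition , size≡d = ∈-columnSplits⁺ M d (record
  { r≤M           = len≤M
  ; r≤d           = subst (r ≤_) size≡d (length≤size λp (isPartition⇒positive λp λp-isPartition))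
  ; μ-isPartition = isPartition-removeColumn λp λp-isPartition
  ; size-μ        = trans (sym (ℕₚ.m+n∸n≡m (size μ) r)) (cong (_∸ r) size≡)
  ; len-μ≤r       = length-removeColumn λp
  })
  where
  r = len λp
  μ = removeColumn λp
  size≡ : size μ ℕ.+ r ≡ d
  size≡ = trans (sym (size-addColumn r μ (length-removeColumn λp)))
                (trans (cong size (addColumn-removeColumn λp λp-isPartition)) size≡d)

addColumn-↭ : ∀ M d → map (uncurry addColumn) (columnSplits M d) ↭ shortPartitions M d
addColumn-↭ M d = ∼bag⇒↭ (unique∧set⇒bag
  (Unique-map-injectiveOn (uncurry addColumn) (addColumn-injectiveOn M d) (columnSplits-unique M d))
  (Uniqueₚ.filter⁺ (λ λp → len λp ℕ.≤? M) (partitions-unique d))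
  (mk⇔ forth back))
  where
  forth : ∀ {λp} → λp ∈ map (uncurry addColumn) (columnSplits M d) → λp ∈ shortPartitions M d
  forth λp∈ with ∈ₚ.∈-map⁻ (uncurry addColumn) λp∈
  ... | _ , rμ∈ , refl = addColumn-∈-shortPartitions M d rμ∈
  back : ∀ {λp} → λp ∈ shortPartitions M d → λp ∈ map (uncurry addColumn) (columnSplits M d)
  back {λp} λp∈ with ∈-partitions⁻ d (proj₁ (∈ₚ.∈-filter⁻ (λ λp → len λp ℕ.≤? M) λp∈))
  ... | λp-isPartition , _ =
    subst (_∈ map (uncurry addColumn) (columnSplits M d)) (addColumn-removeColumn λp λp-isPartition)
          (∈ₚ.∈-map⁺ (uncurry addColumn) (removeColumn-∈-columnSplits M d λp∈))

∑-filter : ∀ {A : Set} {P : A → Set} (P? : Decidable P) xs f → (∀ x → ¬ P x → f x ≡ 0ℤ) →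
           ∑ xs f ≡ ∑ (filter P? xs) f
∑-filter P? []       f f≡0 = refl
∑-filter P? (x ∷ xs) f f≡0 with P? x
... | yes _  = cong (_+_ (f x)) (∑-filter P? xs f f≡0)
... | no ¬px = trans (cong (_+ ∑ xs f) (f≡0 x ¬px)) (trans (ℤₚ.+-identityˡ _) (∑-filter P? xs f f≡0))

∑-pairs : ∀ {A B : Set} (xs : List A) (K : A → List B) f →
          ∑ (pairs xs K) f ≡ ∑ xs (λ a → ∑ (K a) (λ b → f (a , b)))
∑-pairs xs K f = trans (∑-concatMap _ xs f) (∑-cong xs (λ a _ → ∑-map (a ,_) (K a) f))

∑-tuples-suc : ∀ n {A : Set} (L : Fin (suc n) → List A) G →
               ∑ (tuples (suc n) L) G ≡ ∑ (L 0F) (λ a → ∑ (tuples n (L ∘ Fin.suc)) (λ t → G (a ∷ᶠ t)))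
∑-tuples-suc n L G = trans (∑-concatMap _ (L 0F) G) (∑-cong (L 0F) (λ a _ → ∑-map (a ∷ᶠ_) (tuples n (L ∘ Fin.suc)) G))

Respects≗ : ∀ {A : Set} n → ((Fin n → A) → ℤ) → Set
Respects≗ n G = ∀ {t t′} → t ≗ t′ → G t ≡ G t′

∷ᶠ-cong : ∀ {A : Set} {n} (a : A) {t t′ : Fin n → A} → t ≗ t′ → (a ∷ᶠ t) ≗ (a ∷ᶠ t′)
∷ᶠ-cong a t≗t′ 0F          = refl
∷ᶠ-cong a t≗t′ (Fin.suc i) = t≗t′ i

∑-tuples-cong : ∀ n {A : Set} (L : Fin n → List A) {G G′ : (Fin n → A) → ℤ} →
                (∀ t → (∀ i → t i ∈ L i) → G t ≡ G′ t) → ∑ (tuples n L) G ≡ ∑ (tuples n L) G′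
∑-tuples-cong zero    L G≡G′ = cong (_+ 0ℤ) (G≡G′ _ (λ ()))
∑-tuples-cong (suc n) L {G} {G′} G≡G′ = begin
  ∑ (tuples (suc n) L) G
    ≡⟨ ∑-tuples-suc n L G ⟩
  ∑ (L 0F) (λ a → ∑ (tuples n (L ∘ Fin.suc)) (λ t → G (a ∷ᶠ t)))
    ≡⟨ ∑-cong (L 0F) (λ a a∈ → ∑-tuples-cong n (L ∘ Fin.suc)
                                 (λ t t∈ → G≡G′ (a ∷ᶠ t) (λ { 0F → a∈ ; (Fin.suc i) → t∈ i }))) ⟩
  ∑ (L 0F) (λ a → ∑ (tuples n (L ∘ Fin.suc)) (λ t → G′ (a ∷ᶠ t)))
    ≡⟨ ∑-tuples-suc n L G′ ⟨
  ∑ (tuples (suc n) L) G′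
    ∎
  where open ≡-Reasoning

∑-tuples-filter : ∀ n {A : Set} (L : Fin n → List A) {P : Fin n → A → Set} (P? : ∀ i → Decidable (P i))
                  (G : (Fin n → A) → ℤ) → (∀ t i → ¬ P i (t i) → G t ≡ 0ℤ) →
                  ∑ (tuples n L) G ≡ ∑ (tuples n (λ i → filter (P? i) (L i))) G
∑-tuples-filter zero    L P? G G≡0 = refl
∑-tuples-filter (suc n) L P? G G≡0 = begin
  ∑ (tuples (suc n) L) G
    ≡⟨ ∑-tuples-suc n L G ⟩
  ∑ (L 0F) (λ a → ∑ (tuples n (L ∘ Fin.suc)) (λ t → G (a ∷ᶠ t)))
    ≡⟨ ∑-filter (P? 0F) (L 0F) _ (λ a ¬Pa → trans (∑-cong (tuples n (L ∘ Fin.suc)) (λ t _ → G≡0 (a ∷ᶠ t) 0F ¬Pa))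
                                                   (∑-zero (tuples n (L ∘ Fin.suc)))) ⟩
  ∑ (filter (P? 0F) (L 0F)) (λ a → ∑ (tuples n (L ∘ Fin.suc)) (λ t → G (a ∷ᶠ t)))
    ≡⟨ ∑-cong (filter (P? 0F) (L 0F)) (λ a _ →
         ∑-tuples-filter n (L ∘ Fin.suc) (P? ∘ Fin.suc) (λ t → G (a ∷ᶠ t)) (λ t i → G≡0 (a ∷ᶠ t) (Fin.suc i))) ⟩
  ∑ (filter (P? 0F) (L 0F)) (λ a → ∑ (tuples n (λ i → filter (P? (Fin.suc i)) (L (Fin.suc i)))) (λ t → G (a ∷ᶠ t)))
    ≡⟨ ∑-tuples-suc n (λ i → filter (P? i) (L i)) G ⟨
  ∑ (tuples (suc n) (λ i → filter (P? i) (L i))) G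
    ∎
  where open ≡-Reasoning

∑-tuples-reindex : ∀ n {A B : Set} (As : Fin n → List A) (Bs : Fin n → List B) (φ : A → B) (G : (Fin n → B) → ℤ) →
                   (∀ i → map φ (As i) ↭ Bs i) → Respects≗ n G →
                   ∑ (tuples n Bs) G ≡ ∑ (tuples n As) (λ t → G (φ ∘ t))
∑-tuples-reindex zero    As Bs φ G φAs↭Bs G-resp = cong (_+ 0ℤ) (G-resp (λ ()))
∑-tuples-reindex (suc n) As Bs φ G φAs↭Bs G-resp = begin
  ∑ (tuples (suc n) Bs) G
    ≡⟨ ∑-tuples-suc n Bs G ⟩
  ∑ (Bs 0F) (λ b → ∑ (tuples n (Bs ∘ Fin.suc)) (λ t → G (b ∷ᶠ t)))
    ≡⟨ ∑-↭ _ (φAs↭Bs 0F) ⟨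
  ∑ (map φ (As 0F)) (λ b → ∑ (tuples n (Bs ∘ Fin.suc)) (λ t → G (b ∷ᶠ t)))
    ≡⟨ ∑-map φ (As 0F) _ ⟩
  ∑ (As 0F) (λ a → ∑ (tuples n (Bs ∘ Fin.suc)) (λ t → G (φ a ∷ᶠ t)))
    ≡⟨ ∑-cong (As 0F) (λ a _ → ∑-tuples-reindex n (As ∘ Fin.suc) (Bs ∘ Fin.suc) φ (λ t → G (φ a ∷ᶠ t))
                                  (φAs↭Bs ∘ Fin.suc) (G-resp ∘ ∷ᶠ-cong (φ a))) ⟩
  ∑ (As 0F) (λ a → ∑ (tuples n (As ∘ Fin.suc)) (λ u → G (φ a ∷ᶠ (φ ∘ u))))
    ≡⟨ ∑-cong (As 0F) (λ a _ → ∑-cong (tuples n (As ∘ Fin.suc)) (λ u _ →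
         G-resp (λ { 0F → refl ; (Fin.suc i) → refl }))) ⟩
  ∑ (As 0F) (λ a → ∑ (tuples n (As ∘ Fin.suc)) (λ u → G (φ ∘ (a ∷ᶠ u))))
    ≡⟨ ∑-tuples-suc n As (λ t → G (φ ∘ t)) ⟨
  ∑ (tuples (suc n) As) (λ t → G (φ ∘ t))
    ∎
  where open ≡-Reasoning

∑-tuples-pairs : ∀ n {A B : Set} (L : Fin n → List A) (K : Fin n → A → List B) (G : (Fin n → A × B) → ℤ) →
                 Respects≗ n G →
                 ∑ (tuples n L) (λ r → ∑ (tuples n (λ i → K i (r i))) (λ μ → G (λ i → r i , μ i)))
                   ≡ ∑ (tuples n (λ i → pairs (L i) (K i))) G
∑-tuples-pairs zero    L K G G-resp = cong (_+ 0ℤ) (trans (ℤₚ.+-identityʳ _) (G-resp (λ ())))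
∑-tuples-pairs (suc n) L K G G-resp = begin
  ∑ (tuples (suc n) L) (λ r → ∑ (tuples (suc n) (λ i → K i (r i))) (λ μ → G (λ i → r i , μ i)))
    ≡⟨ ∑-tuples-suc n L _ ⟩
  ∑ (L 0F) (λ a → ∑ (tuples n (L ∘ Fin.suc)) (λ t →
    ∑ (tuples (suc n) (λ i → K i ((a ∷ᶠ t) i))) (λ μ → G (λ i → (a ∷ᶠ t) i , μ i))))
    ≡⟨ ∑-cong (L 0F) (λ a _ → ∑-cong (tuples n (L ∘ Fin.suc)) (λ t _ → ∑-tuples-suc n (λ i → K i ((a ∷ᶠ t) i)) _)) ⟩
  ∑ (L 0F) (λ a → ∑ (tuples n (L ∘ Fin.suc)) (λ t → ∑ (K 0F a) (λ b →
    ∑ (tuples n (λ i → K (Fin.suc i) (t i))) (λ u → G (λ i → (a ∷ᶠ t) i , (b ∷ᶠ u) i)))))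
    ≡⟨ ∑-cong (L 0F) (λ a _ → ∑-swap (tuples n (L ∘ Fin.suc)) (K 0F a) _) ⟩
  ∑ (L 0F) (λ a → ∑ (K 0F a) (λ b → ∑ (tuples n (L ∘ Fin.suc)) (λ t →
    ∑ (tuples n (λ i → K (Fin.suc i) (t i))) (λ u → G (λ i → (a ∷ᶠ t) i , (b ∷ᶠ u) i)))))
    ≡⟨ ∑-cong (L 0F) (λ a _ → ∑-cong (K 0F a) (λ b _ → trans
         (∑-cong (tuples n (L ∘ Fin.suc)) (λ t _ → ∑-cong (tuples n (λ i → K (Fin.suc i) (t i))) (λ u _ →
           G-resp (λ { 0F → refl ; (Fin.suc i) → refl }))))
         (∑-tuples-pairs n (L ∘ Fin.suc) (K ∘ Fin.suc) (λ q → G ((a , b) ∷ᶠ q)) (G-resp ∘ ∷ᶠ-cong (a , b))))) ⟩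
  ∑ (L 0F) (λ a → ∑ (K 0F a) (λ b → ∑ (tuples n (λ i → pairs (L (Fin.suc i)) (K (Fin.suc i)))) (λ q → G ((a , b) ∷ᶠ q))))
    ≡⟨ ∑-pairs (L 0F) (K 0F) _ ⟨
  ∑ (pairs (L 0F) (K 0F)) (λ ab → ∑ (tuples n (λ i → pairs (L (Fin.suc i)) (K (Fin.suc i)))) (λ q → G (ab ∷ᶠ q)))
    ≡⟨ ∑-tuples-suc n (λ i → pairs (L i) (K i)) G ⟨
  ∑ (tuples (suc n) (λ i → pairs (L i) (K i))) G
    ∎
  where open ≡-Reasoning

allFinB-true : ∀ n (p : Fin n → Bool) → (∀ i → p i ≡ true) → allFinB n p ≡ true
allFinB-true n p p≡true = go (allFin n)
  where
  go : ∀ xs → foldr _∧_ true (map p xs) ≡ true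
  go []       = refl
  go (x ∷ xs) rewrite p≡true x = go xs

allFinB-false : ∀ n (p : Fin n → Bool) i → p i ≡ false → allFinB n p ≡ false
allFinB-false n p i pi≡false = go (allFin n) (∈ₚ.∈-allFin i)
  where
  go : ∀ xs → i ∈ xs → foldr _∧_ true (map p xs) ≡ false
  go (x ∷ xs) (here refl) rewrite pi≡false = refl
  go (x ∷ xs) (there i∈xs) with p x
  ... | true  = go xs i∈xs
  ... | false = refl

allFinB-cong : ∀ n {p q : Fin n → Bool} → p ≗ q → allFinB n p ≡ allFinB n q
allFinB-cong n p≗q = cong (foldr _∧_ true) (Listₚ.map-cong p≗q (allFin n))

∈⇒≤sumℕ : ∀ {A : Set} (f : A → ℕ) {x xs} → x ∈ xs → f x ≤ sumℕ (map f xs)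
∈⇒≤sumℕ f {xs = y ∷ xs} (here refl) = ℕₚ.m≤m+n (f y) _
∈⇒≤sumℕ f {xs = y ∷ xs} (there x∈) = ℕₚ.≤-trans (∈⇒≤sumℕ f x∈) (ℕₚ.m≤n+m _ (f y))

outerFactor : ∀ n → (Fin n → ℕ) → (Fin n → ℕ) → QS
outerFactor n M r =
  shiftS (halfCartanForm n (λ i j → r i ℕ.* r j)) (inv (prodS (map (λ i → poch (M i ∸ r i)) (allFin n))))

outerFactor-cong : ∀ n M {r r′ : Fin n → ℕ} → r ≗ r′ → outerFactor n M r ≡ outerFactor n M r′
outerFactor-cong n M r≗r′ =
  cong₂ shiftS (halfCartanForm-cong n (λ i j → cong₂ ℕ._*_ (r≗r′ i) (r≗r′ j)))
               (cong (inv ∘ prodS) (Listₚ.map-cong (λ i → cong (λ x → poch (M i ∸ x)) (r≗r′ i)) (allFin n)))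

RTerm-cong : ∀ n {M M′ : Fin n → ℕ} {λs λs′ : Fin n → Partition} → M ≗ M′ → λs ≗ λs′ →
             RTerm n M λs ≡ RTerm n M′ λs′
RTerm-cong n M≗M′ λs≗λs′ = cong₂ (λ b f → if b then f else zeroS)
  (allFinB-cong n (λ i → cong₂ (λ λp m → len λp ≤ᵇ m) (λs≗λs′ i) (M≗M′ i)))
  (cong₂ shiftS
    (halfCartanForm-cong n (λ i j → cong₂ (λ λp κ → inner (conj λp) (conj κ)) (λs≗λs′ i) (λs≗λs′ j)))
    (cong (inv ∘ prodS)
          (Listₚ.map-cong (λ i → cong₂ (λ m λp → poch (m ∸ len λp) ⊗ bPoly λp) (M≗M′ i) (λs≗λs′ i)) (allFin n))))

RTerm-short : ∀ n M λs → (∀ i → len (λs i) ≤ M i) →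
  RTerm n M λs ≡ shiftS (halfCartanForm n (λ i j → inner (conj (λs i)) (conj (λs j))))
                        (inv (prodS (map (λ i → poch (M i ∸ len (λs i)) ⊗ bPoly (λs i)) (allFin n))))
RTerm-short n M λs short
  rewrite allFinB-true n (λ i → len (λs i) ≤ᵇ M i) (λ i → dec-true (len (λs i) ℕ.≤? M i) (short i)) = refl

RTerm-long : ∀ n M λs i → ¬ len (λs i) ≤ M i → RTerm n M λs ≡ zeroS
RTerm-long n M λs i long
  rewrite allFinB-false n (λ i → len (λs i) ≤ᵇ M i) i (dec-false (len (λs i) ℕ.≤? M i) long) = refl

halfCartanForm-addColumn : ∀ n (r : Fin n → ℕ) (μs : Fin n → Partition) → (∀ i → len (μs i) ≤ r i) →
  halfCartanForm n (λ i j → inner (conj (addColumn (r i) (μs i))) (conj (addColumn (r j) (μs j))))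
    ≡ halfCartanForm n (λ i j → r i ℕ.* r j) ℕ.+ halfCartanForm n (λ i j → inner (conj (μs i)) (conj (μs j)))
halfCartanForm-addColumn n r μs μs≤r =
  halfCartanForm-+ n (λ i j → inner-conj-addColumn (r i) (μs i) (r j) (μs j) (μs≤r i) (μs≤r j))
    (cartanSum-rank1-double n r)
    (subst IsDouble (cartanSum-cong n (λ i j → sym (inner-conj (μs i) (μs j) N (size≤N i))))
           (cartanSum-gram-double n N (λ i → conjAt (μs i))))
  where
  N = sumℕ (map (λ i → size (μs i)) (allFin n))
  size≤N : ∀ i → size (μs i) ≤ N
  size≤N i = ∈⇒≤sumℕ (λ i → size (μs i)) (∈ₚ.∈-allFin i)

denominator-addColumn : ∀ n (M r : Fin n → ℕ) (μs : Fin n → Partition) →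
  (∀ i → IsPartition (μs i)) → (∀ i → len (μs i) ≤ r i) →
  prodS (map (λ i → poch (M i ∸ r i)) (allFin n)) ⊗ prodS (map (λ i → poch (r i ∸ len (μs i)) ⊗ bPoly (μs i)) (allFin n))
    ≗ prodS (map (λ i → poch (M i ∸ len (addColumn (r i) (μs i))) ⊗ bPoly (addColumn (r i) (μs i))) (allFin n))
denominator-addColumn n M r μs μs-partitions μs≤r k =
  trans (sym (prodS-map-⊗ (λ i → poch (M i ∸ r i)) (λ i → poch (r i ∸ len (μs i)) ⊗ bPoly (μs i)) (allFin n) k))
        (prodS-cong (allFin n) factor k)
  where
  factor : ∀ i → poch (M i ∸ r i) ⊗ (poch (r i ∸ len (μs i)) ⊗ bPoly (μs i))
                 ≗ poch (M i ∸ len (addColumn (r i) (μs i))) ⊗ bPoly (addColumn (r i) (μs i))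
  factor i rewrite length-addColumn (r i) (μs i) (μs≤r i) = ⊗-congˡ (poch (M i ∸ r i)) (λ k →
    sym (bPoly-addColumn (r i) (μs i) (isPartition⇒positive (μs i) (μs-partitions i)) (μs≤r i) k))

outerFactor-⊗-RTerm : ∀ n (M r : Fin n → ℕ) (μs : Fin n → Partition) →
  (∀ i → IsPartition (μs i)) → (∀ i → len (μs i) ≤ r i) → (∀ i → r i ≤ M i) →
  outerFactor n M r ⊗ RTerm n r μs ≗ RTerm n M (λ i → addColumn (r i) (μs i))
outerFactor-⊗-RTerm n M r μs μs-partitions μs≤r r≤M = begin
  outerFactor n M r ⊗ RTerm n r μs
    ≈⟨ ⊗-congˡ (outerFactor n M r) (λ k → cong (λ f → f k) (RTerm-short n r μs μs≤r)) ⟩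
  shiftS Hr (inv Pr) ⊗ shiftS Hμ (inv Pμ)
    ≈⟨ shiftS-⊗-shiftS Hr Hμ (inv Pr) (inv Pμ) ⟩
  shiftS (Hr ℕ.+ Hμ) (inv Pr ⊗ inv Pμ)
    ≈⟨ shiftS-cong (Hr ℕ.+ Hμ) (inv-⊗ Pr Pμ Pr-const Pμ-const) ⟩
  shiftS (Hr ℕ.+ Hμ) (inv (Pr ⊗ Pμ))
    ≈⟨ shiftS-cong (Hr ℕ.+ Hμ) (inv-cong (⊗-const Pr Pμ Pr-const Pμ-const)
                                         (denominator-addColumn n M r μs μs-partitions μs≤r)) ⟩
  shiftS (Hr ℕ.+ Hμ) (inv Pλ)
    ≡⟨ cong (λ h → shiftS h (inv Pλ)) (halfCartanForm-addColumn n r μs μs≤r) ⟨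
  shiftS Hλ (inv Pλ)
    ≡⟨ RTerm-short n M λs (λ i → subst (_≤ M i) (sym (length-addColumn (r i) (μs i) (μs≤r i))) (r≤M i)) ⟨
  RTerm n M λs
    ∎
  where
  open ≗-Reasoning
  λs : Fin n → Partition
  λs i = addColumn (r i) (μs i)
  Hr = halfCartanForm n (λ i j → r i ℕ.* r j)
  Hμ = halfCartanForm n (λ i j → inner (conj (μs i)) (conj (μs j)))
  Hλ = halfCartanForm n (λ i j → inner (conj (λs i)) (conj (λs j)))
  Pr = prodS (map (λ i → poch (M i ∸ r i)) (allFin n))
  Pμ = prodS (map (λ i → poch (r i ∸ len (μs i)) ⊗ bPoly (μs i)) (allFin n))
  Pλ = prodS (map (λ i → poch (M i ∸ len (λs i)) ⊗ bPoly (λs i)) (allFin n))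
  Pr-const : Pr 0 ≡ + 1
  Pr-const = prodS-const _ (Allₚ.map⁺ (All.universal (λ i → poch-const (M i ∸ r i)) (allFin n)))
  Pμ-const : Pμ 0 ≡ + 1
  Pμ-const = prodS-const _ (Allₚ.map⁺ (All.universal (λ i → ⊗-const (poch (r i ∸ len (μs i))) (bPoly (μs i))
                                                                 (poch-const (r i ∸ len (μs i))) (bPoly-const (μs i)))
                                                      (allFin n)))

module _ (n : ℕ) (M d : Fin n → ℕ) (k : ℕ) where

  splitTerm : (Fin n → ℕ × Partition) → ℤ
  splitTerm p = if allFinB n (λ i → r i ≤ᵇ d i) then (outerFactor n M r ⊗ RTerm n r (proj₂ ∘ p)) k else 0ℤ
    where r = proj₁ ∘ p

  splitTerm-respects : Respects≗ n splitTerm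
  splitTerm-respects p≗p′ = cong₂ (λ b x → if b then x else 0ℤ)
    (allFinB-cong n (λ i → cong (λ rμ → proj₁ rμ ≤ᵇ d i) (p≗p′ i)))
    (cong (λ f → f k) (cong₂ _⊗_ (outerFactor-cong n M (cong proj₁ ∘ p≗p′))
                                 (RTerm-cong n (cong proj₁ ∘ p≗p′) (cong proj₂ ∘ p≗p′))))

  LHS-as-splitSum :
    LHS n M d k ≡ ∑ (tuples n (λ i → pairs (upTo (suc (M i))) (λ r → partitions (d i ∸ r)))) splitTerm
  LHS-as-splitSum = begin
    LHS n M d k
      ≡⟨ sumS-coeff (λ F → F d) (map summand (box n M)) k ⟩
    ∑ (map summand (box n M)) (λ F → F d k)
      ≡⟨ ∑-map summand (box n M) (λ F → F d k) ⟩
    ∑ (box n M) (λ r → summand r d k)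
      ≡⟨ ∑-cong (box n M) (λ r _ → summand-coeff r) ⟩
    ∑ (box n M) (λ r → ∑ (tuples n (λ i → partitions (d i ∸ r i))) (λ μs → splitTerm (λ i → r i , μs i)))
      ≡⟨ ∑-tuples-pairs n (λ i → upTo (suc (M i))) (λ i r → partitions (d i ∸ r)) splitTerm splitTerm-respects ⟩
    ∑ (tuples n (λ i → pairs (upTo (suc (M i))) (λ r → partitions (d i ∸ r)))) splitTerm
      ∎
    where
    open ≡-Reasoning
    summand : (Fin n → ℕ) → MS n
    summand r = mulA r (scaleQ (outerFactor n M r) (R n r))
    summand-coeff : ∀ r → summand r d k
                          ≡ ∑ (tuples n (λ i → partitions (d i ∸ r i))) (λ μs → splitTerm (λ i → r i , μs i))
    summand-coeff r with allFinB n (λ i → r i ≤ᵇ d i)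
    ... | true  = ⊗-sumS (outerFactor n M r) (RTerm n r) (tuples n (λ i → partitions (d i ∸ r i))) k
    ... | false = sym (∑-zero (tuples n (λ i → partitions (d i ∸ r i))))

  splitTerm-invalid : ∀ p i → ¬ ValidSplit (d i) (p i) → splitTerm p ≡ 0ℤ
  splitTerm-invalid p i invalid with proj₁ (p i) ℕ.≤? d i
  ... | no r≰d
    rewrite allFinB-false n (λ i → proj₁ (p i) ≤ᵇ d i) i (dec-false (proj₁ (p i) ℕ.≤? d i) r≰d) = refl
  ... | yes r≤d with allFinB n (λ i → proj₁ (p i) ≤ᵇ d i)
  ...   | false = refl
  ...   | true  =
    trans (cong (λ f → (outerFactor n M (proj₁ ∘ p) ⊗ f) k) (RTerm-long n (proj₁ ∘ p) (proj₂ ∘ p) i (invalid ∘ (r≤d ,_))))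
          (⊗-zeroS (outerFactor n M (proj₁ ∘ p)) k)

  splitTerm-valid : ∀ p → (∀ i → p i ∈ columnSplits (M i) (d i)) →
                    splitTerm p ≡ RTerm n M (uncurry addColumn ∘ p) k
  splitTerm-valid p p∈ = trans
    (cong (λ b → if b then (outerFactor n M r ⊗ RTerm n r μs) k else 0ℤ)
          (allFinB-true n (λ i → r i ≤ᵇ d i) (λ i → dec-true (r i ℕ.≤? d i) (IsColumnSplit.r≤d (split i)))))
    (outerFactor-⊗-RTerm n M r μs (IsColumnSplit.μ-isPartition ∘ split) (IsColumnSplit.len-μ≤r ∘ split)
                                  (IsColumnSplit.r≤M ∘ split) k)
    where
    r = proj₁ ∘ p
    μs = proj₂ ∘ p
    split : ∀ i → IsColumnSplit (M i) (d i) (r i) (μs i)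
    split i = ∈-columnSplits⁻ (M i) (d i) (p∈ i)

RTerm-respects : ∀ n M k → Respects≗ n (λ λs → RTerm n M λs k)
RTerm-respects n M k λs≗λs′ = cong (λ f → f k) (RTerm-cong n (λ _ → refl) λs≗λs′)

lemma5p1 : (n : ℕ) → 1 ≤ n → (M : Fin n → ℕ) →
    (d : Fin n → ℕ) → (k : ℕ) → LHS n M d k ≡ R n M d k
lemma5p1 n _ M d k = begin
  LHS n M d k
    ≡⟨ LHS-as-splitSum n M d k ⟩
  ∑ (tuples n (λ i → pairs (upTo (suc (M i))) (λ r → partitions (d i ∸ r)))) (splitTerm n M d k)
    ≡⟨ ∑-tuples-filter n _ (validSplit? ∘ d) (splitTerm n M d k) (splitTerm-invalid n M d k) ⟩
  ∑ (tuples n (λ i → columnSplits (M i) (d i))) (splitTerm n M d k)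
    ≡⟨ ∑-tuples-cong n _ (splitTerm-valid n M d k) ⟩
  ∑ (tuples n (λ i → columnSplits (M i) (d i))) (λ p → RTerm n M (uncurry addColumn ∘ p) k)
    ≡⟨ ∑-tuples-reindex n _ _ (uncurry addColumn) (λ λs → RTerm n M λs k)
                        (λ i → addColumn-↭ (M i) (d i)) (RTerm-respects n M k) ⟨
  ∑ (tuples n (λ i → shortPartitions (M i) (d i))) (λ λs → RTerm n M λs k)
    ≡⟨ ∑-tuples-filter n (partitions ∘ d) (λ i λp → len λp ℕ.≤? M i) (λ λs → RTerm n M λs k)
                       (λ λs i long → cong (λ f → f k) (RTerm-long n M λs i long)) ⟨
  ∑ (tuples n (partitions ∘ d)) (λ λs → RTerm n M λs k)
    ≡⟨ sumS-coeff (RTerm n M) (tuples n (partitions ∘ d)) k ⟨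
  R n M d k
    ∎
  where open ≡-Reasoning
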